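{- Let $k\ge1$ be an integer, let $\gamma>0$, and let $\mathcal{AM}_k$ be the set of alternating Motzkin paths of length $2k$. For $p\in\mathcal{AM}_k$ let $r(p)$ be its number of rises; for $0\le i\le k-1$ let $R_i(p)$ be the number of rises of $p$ from altitude $i$ to altitude $i+1$, and let $L_i(p)$ be the number of level steps of $p$ at altitude $i$ which occur at even-numbered steps; put $\vec R=(R_0,\dots,R_{k-1})$, $\vec L=(L_0,\dots,L_{k-1})$. Let $E$ denote expectation with respect to the probability distribution on $\mathcal{AM}_k$ giving each path $p$ probability proportional to $\gamma^{r(p)}$. Then \[ \| E[\vec{R}]\|^2_2+\gamma\,\| E[\vec{L}]\|_2^2 \;=\; \frac{1}{N_k(\gamma)^2} \sum_{p_1,p_2 \in \mathcal{AM}_k} \gamma^{r(p_1)+r(p_2)} \Big(\sum_{i=0}^{k-1} R_i(p_1)R_i(p_2) + \gamma \sum_{i=0}^{k-1} L_i(p_1)L_i(p_2) \Big) \;=\; \frac{N_{2k}(\gamma)}{N_k(\gamma)^2}-1, \] where $N_m(\gamma)=\sum_{r=0}^{m-1}\gamma^r\frac{1}{r+1}\binom{m}{r}\binom{m-1}{r}$ is the Narayana polynomial.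
   Context: A Motzkin path of length $2k$ is a lattice path of $2k$ steps, each a rise $(1,1)$, a fall $(1,-1)$ or a level step $(1,0)$, starting at $(0,0)$, ending at $(2k,0)$, never going below the $x$-axis. Steps are numbered $1,2,\dots,2k$ from left to right. An alternating Motzkin path is a Motzkin path in which rises occur only at even-numbered steps and falls occur only at odd-numbered steps. The altitude of a level step is the $y$-coordinate of its endpoints. The number of alternating Motzkin paths of length $2k$ with $r$ rises is $\frac{1}{r+1}\binom{k}{r}\binom{k-1}{r}$, so $\sum_{p\in\mathcal{AM}_k}\gamma^{r(p)}=N_k(\gamma)$.
   Formalization: The parameter γ ranges over the positive rationals. -}

module Defs where

open import Data.Bool using (Bool; true; false; _∧_)
open import Data.Nat as ℕ using (ℕ; zero; suc; _∸_)
open import Data.Nat.Combinatorics using (_C_)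
open import Data.Integer as ℤ using (ℤ; +_; -[1+_])
open import Data.Rational as ℚ using (ℚ; mkℚ; 0ℚ; 1ℚ; _÷_)
open import Data.List using (List; []; _∷_; _++_; map; concatMap; filterᵇ; upTo; foldr)

data Step : Set where
  rise fall level : Step

words : ℕ → List (List Step)
words zero    = [] ∷ []
words (suc n) = concatMap (λ w → (rise ∷ w) ∷ (fall ∷ w) ∷ (level ∷ w) ∷ []) (words n)

isEven : ℕ → Bool
isEven zero          = true
isEven (suc zero)    = false
isEven (suc (suc n)) = isEven n

isOdd : ℕ → Bool
isOdd zero          = false
isOdd (suc zero)    = true
isOdd (suc (suc n)) = isOdd n

-- altCheck j h s : the remaining steps s, the first of which has number j,
-- starting at altitude h, never go below the x-axis, end at altitude 0,
-- rises only at even-numbered steps, falls only at odd-numbered steps.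
altCheck : ℕ → ℕ → List Step → Bool
altCheck j zero    []            = true
altCheck j (suc h) []            = false
altCheck j h       (rise ∷ s)    = isEven j ∧ altCheck (suc j) (suc h) s
altCheck j zero    (fall ∷ s)    = false
altCheck j (suc h) (fall ∷ s)    = isOdd j ∧ altCheck (suc j) h s
altCheck j h       (level ∷ s)   = altCheck (suc j) h s

isAltMotzkin : List Step → Bool
isAltMotzkin = altCheck 1 0

AM : ℕ → List (List Step)
AM k = filterᵇ isAltMotzkin (words (2 ℕ.* k))

rises : List Step → ℕ
rises []           = 0
rises (rise ∷ s)   = suc (rises s)
rises (fall ∷ s)   = rises s
rises (level ∷ s)  = rises s

Rgo : ℕ → ℕ → List Step → ℕ
Rgo i h []          = 0
Rgo i h (rise ∷ s)  with h ℕ.≡ᵇ i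
... | true  = suc (Rgo i (suc h) s)
... | false = Rgo i (suc h) s
Rgo i h (fall ∷ s)  = Rgo i (h ∸ 1) s
Rgo i h (level ∷ s) = Rgo i h s

R : ℕ → List Step → ℕ
R i = Rgo i 0

Lgo : ℕ → ℕ → ℕ → List Step → ℕ
Lgo i j h []          = 0
Lgo i j h (rise ∷ s)  = Lgo i (suc j) (suc h) s
Lgo i j h (fall ∷ s)  = Lgo i (suc j) (h ∸ 1) s
Lgo i j h (level ∷ s) with isEven j ∧ (h ℕ.≡ᵇ i)
... | true  = suc (Lgo i (suc j) h s)
... | false = Lgo i (suc j) h s

L : ℕ → List Step → ℕ
L i = Lgo i 1 0

infixr 8 _^_
_^_ : ℚ → ℕ → ℚ
q ^ zero  = 1ℚ
q ^ suc n = q ℚ.* (q ^ n)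

fromℕ : ℕ → ℚ
fromℕ n = (+ n) ℚ./ 1

-- Division; the divisor is always nonzero where it is used (convention x/0 = 0).
infixl 7 _/'_
_/'_ : ℚ → ℚ → ℚ
p /' mkℚ (+ zero) _ _          = 0ℚ
p /' q@(mkℚ (+ suc n) _ _)     = p ÷ q
p /' q@(mkℚ -[1+ n ] _ _)      = p ÷ q

Σℚ : {A : Set} → List A → (A → ℚ) → ℚ
Σℚ xs f = foldr (λ x acc → f x ℚ.+ acc) 0ℚ xs

Σ< : ℕ → (ℕ → ℚ) → ℚ
Σ< n f = Σℚ (upTo n) f

Narayana : ℕ → ℚ → ℚ
Narayana m γ = Σ< m (λ r → γ ^ r ℚ.* ((+ ((m C r) ℕ.* ((m ∸ 1) C r))) ℚ./ suc r))

E : ℕ → ℚ → (List Step → ℚ) → ℚ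
E k γ X = Σℚ (AM k) (λ p → γ ^ rises p ℚ.* X p) /' Σℚ (AM k) (λ p → γ ^ rises p)

normSq : ℕ → (ℕ → ℚ) → ℚ
normSq n v = Σ< n (λ i → v i ℚ.* v i)

module Submission where

-- Let pathSum n h be the γ ^ rises-weighted number of alternating paths of n (odd, even) pairs of steps
-- from altitude h down to 0. Reading a path pair by pair gives pathSum (n + 1) = T (pathSum n) for the
-- operator (T v) h = v (h - 1) + (1 + γ) v h + γ v (h + 1) (and (T v) 0 = v 0 + γ v 1), which is
-- self-adjoint for the weights γ ^ h; hence Σ_h γ ^ h pathSum k h ^ 2 = pathSum (2k) 0 = N_2k(γ).
-- The unnormalised moments Σ_p γ ^ r(p) R_i(p) and Σ_p γ ^ r(p) L_i(p) obey the same recursion with a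
-- source at altitudes i and i + 1, and solving it gives γ ^ (i + 1) pathSum k (2i + 2) and
-- γ ^ i pathSum k (2i + 1). Thus the terms h = 2i + 2, h = 2i + 1 and h = 0 of that sum are the squared
-- R-moments, γ times the squared L-moments and N_k(γ) ^ 2, while the first equality is just the
-- expansion of the squares. Finally pathSum n 0 = N_n(γ) by the reflection principle for the path counts.

open import Defs
open import Data.Nat as ℕ using (ℕ; _≤_; zero; suc; s≤s; _∸_)
import Data.Nat.Properties as ℕP
import Data.Nat.Tactic.RingSolver as ℕ-Solver
open import Data.Nat.Combinatorics using (_C_; nCk+nC[k+1]≡[n+1]C[k+1])
import Data.Integer as ℤ
import Data.Integer.Properties as ℤP
open import Data.Rational as ℚ using (ℚ; 0ℚ; 1ℚ; _<_; _+_; _*_; _-_)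
import Data.Rational.Properties as ℚP
import Data.Rational.Unnormalised as ℚᵘ
import Data.Rational.Unnormalised.Properties as ℚᵘP
open import Data.Bool using (Bool; true; false; if_then_else_; _∧_)
open import Data.List using (List; []; _∷_; _++_; concatMap; filterᵇ; upTo; applyUpTo)
open import Data.Product using (_×_; _,_)
open import Data.Empty using (⊥-elim)
open import Data.Maybe.Base using (Maybe; just; nothing)
open import Relation.Nullary using (yes; no)
open import Relation.Binary.PropositionalEquality
open import Level using (0ℓ)
open import Tactic.RingSolver using () renaming (solve-∀ to ℚ-solve)
open import Tactic.RingSolver.Core.AlmostCommutativeRing using (AlmostCommutativeRing; fromCommutativeRing)

ℚ-ring : AlmostCommutativeRing 0ℓ 0ℓ
ℚ-ring = fromCommutativeRing ℚP.+-*-commutativeRing isZero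
  where
  isZero : ∀ x → Maybe (0ℚ ≡ x)
  isZero x with 0ℚ ℚ.≟ x
  ... | yes e = just e
  ... | no _  = nothing

fromℕ-toℚᵘ : ∀ n → ℚ.toℚᵘ (fromℕ n) ℚᵘ.≃ ℚᵘ.mkℚᵘ (ℤ.+ n) 0
fromℕ-toℚᵘ n = ℚP.toℚᵘ-fromℚᵘ (ℚᵘ.mkℚᵘ (ℤ.+ n) 0)

fromℕ-+ : ∀ m n → fromℕ (m ℕ.+ n) ≡ fromℕ m + fromℕ n
fromℕ-+ m n = ℚP.toℚᵘ-injective (begin
    ℚ.toℚᵘ (fromℕ (m ℕ.+ n))                 ≈⟨ fromℕ-toℚᵘ (m ℕ.+ n) ⟩
    ℚᵘ.mkℚᵘ (ℤ.+ (m ℕ.+ n)) 0                  ≈⟨ ℚᵘ.*≡* (cong (ℤ._* ℤ.+ 1) eq) ⟩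
    ℚᵘ.mkℚᵘ (ℤ.+ m) 0 ℚᵘ.+ ℚᵘ.mkℚᵘ (ℤ.+ n) 0     ≈⟨ ℚᵘP.+-cong (ℚᵘP.≃-sym (fromℕ-toℚᵘ m)) (ℚᵘP.≃-sym (fromℕ-toℚᵘ n)) ⟩
    ℚ.toℚᵘ (fromℕ m) ℚᵘ.+ ℚ.toℚᵘ (fromℕ n)   ≈⟨ ℚᵘP.≃-sym (ℚP.toℚᵘ-homo-+ (fromℕ m) (fromℕ n)) ⟩
    ℚ.toℚᵘ (fromℕ m + fromℕ n)               ∎)
  where
  open ℚᵘP.≃-Reasoning
  eq : ℤ.+ (m ℕ.+ n) ≡ ℤ.+ m ℤ.* ℤ.+ 1 ℤ.+ ℤ.+ n ℤ.* ℤ.+ 1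
  eq = trans (ℤP.pos-+ m n) (sym (cong₂ ℤ._+_ (ℤP.*-identityʳ (ℤ.+ m)) (ℤP.*-identityʳ (ℤ.+ n))))

fromℕ-* : ∀ m n → fromℕ (m ℕ.* n) ≡ fromℕ m * fromℕ n
fromℕ-* m n = ℚP.toℚᵘ-injective (begin
    ℚ.toℚᵘ (fromℕ (m ℕ.* n))                 ≈⟨ fromℕ-toℚᵘ (m ℕ.* n) ⟩
    ℚᵘ.mkℚᵘ (ℤ.+ (m ℕ.* n)) 0                  ≈⟨ ℚᵘ.*≡* (cong (ℤ._* ℤ.+ 1) (ℤP.pos-* m n)) ⟩
    ℚᵘ.mkℚᵘ (ℤ.+ m) 0 ℚᵘ.* ℚᵘ.mkℚᵘ (ℤ.+ n) 0     ≈⟨ ℚᵘP.*-cong (ℚᵘP.≃-sym (fromℕ-toℚᵘ m)) (ℚᵘP.≃-sym (fromℕ-toℚᵘ n)) ⟩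
    ℚ.toℚᵘ (fromℕ m) ℚᵘ.* ℚ.toℚᵘ (fromℕ n)   ≈⟨ ℚᵘP.≃-sym (ℚP.toℚᵘ-homo-* (fromℕ m) (fromℕ n)) ⟩
    ℚ.toℚᵘ (fromℕ m * fromℕ n)               ∎)
  where open ℚᵘP.≃-Reasoning

fromℕ-suc : ∀ n → fromℕ (suc n) ≡ 1ℚ + fromℕ n
fromℕ-suc = fromℕ-+ 1

[1+r]*c/[1+r]≡c : ∀ r c → ℤ.+ (suc r ℕ.* c) ℚ./ suc r ≡ fromℕ c
[1+r]*c/[1+r]≡c r c = ℚP.fromℚᵘ-cong {ℚᵘ.mkℚᵘ (ℤ.+ (suc r ℕ.* c)) r} {ℚᵘ.mkℚᵘ (ℤ.+ c) 0} (ℚᵘ.*≡* eq)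
  where
  eq : ℤ.+ (suc r ℕ.* c) ℤ.* ℤ.+ 1 ≡ ℤ.+ c ℤ.* ℤ.+ suc r
  eq = trans (ℤP.*-identityʳ _) (trans (cong ℤ.+_ (ℕP.*-comm (suc r) c)) (ℤP.pos-* c (suc r)))

^-+ : ∀ (γ : ℚ) a b → γ ^ (a ℕ.+ b) ≡ γ ^ a * γ ^ b
^-+ γ zero    b = sym (ℚP.*-identityˡ (γ ^ b))
^-+ γ (suc a) b = trans (cong (γ *_) (^-+ γ a b)) (sym (ℚP.*-assoc γ (γ ^ a) (γ ^ b)))

module _ {A : Set} where

  Σℚ-cong : ∀ (xs : List A) {f g : A → ℚ} → (∀ x → f x ≡ g x) → Σℚ xs f ≡ Σℚ xs g
  Σℚ-cong []       e = refl
  Σℚ-cong (x ∷ xs) e = cong₂ _+_ (e x) (Σℚ-cong xs e)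

  Σℚ-++ : ∀ (xs ys : List A) (f : A → ℚ) → Σℚ (xs ++ ys) f ≡ Σℚ xs f + Σℚ ys f
  Σℚ-++ []       ys f = sym (ℚP.+-identityˡ _)
  Σℚ-++ (x ∷ xs) ys f = trans (cong (f x +_) (Σℚ-++ xs ys f)) (sym (ℚP.+-assoc (f x) _ _))

  Σℚ-filterᵇ : ∀ (p : A → Bool) (xs : List A) (f : A → ℚ) →
               Σℚ (filterᵇ p xs) f ≡ Σℚ xs (λ x → if p x then f x else 0ℚ)
  Σℚ-filterᵇ p []       f = refl
  Σℚ-filterᵇ p (x ∷ xs) f with p x
  ... | true  = cong (f x +_) (Σℚ-filterᵇ p xs f)
  ... | false = trans (Σℚ-filterᵇ p xs f) (sym (ℚP.+-identityˡ _))

  Σℚ-+ : ∀ (xs : List A) (f g : A → ℚ) → Σℚ xs (λ x → f x + g x) ≡ Σℚ xs f + Σℚ xs g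
  Σℚ-+ []       f g = refl
  Σℚ-+ (x ∷ xs) f g = trans (cong (f x + g x +_) (Σℚ-+ xs f g)) (interchange (f x) (g x) _ _)
    where
    interchange : ∀ a b c d → (a + b) + (c + d) ≡ (a + c) + (b + d)
    interchange = ℚ-solve ℚ-ring

  Σℚ-*ˡ : ∀ (xs : List A) (c : ℚ) (f : A → ℚ) → Σℚ xs (λ x → c * f x) ≡ c * Σℚ xs f
  Σℚ-*ˡ []       c f = sym (ℚP.*-zeroʳ c)
  Σℚ-*ˡ (x ∷ xs) c f = trans (cong (c * f x +_) (Σℚ-*ˡ xs c f)) (sym (ℚP.*-distribˡ-+ c (f x) _))

  Σℚ-*ʳ : ∀ (xs : List A) (c : ℚ) (f : A → ℚ) → Σℚ xs (λ x → f x * c) ≡ Σℚ xs f * c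
  Σℚ-*ʳ xs c f = trans (Σℚ-cong xs (λ x → ℚP.*-comm (f x) c)) (trans (Σℚ-*ˡ xs c f) (ℚP.*-comm c _))

  Σℚ-0 : ∀ (xs : List A) → Σℚ xs (λ _ → 0ℚ) ≡ 0ℚ
  Σℚ-0 []       = refl
  Σℚ-0 (x ∷ xs) = trans (ℚP.+-identityˡ _) (Σℚ-0 xs)

  Σℚ-Σℚ-* : ∀ (xs : List A) (u v : A → ℚ) → Σℚ xs (λ x → Σℚ xs (λ y → u x * v y)) ≡ Σℚ xs u * Σℚ xs v
  Σℚ-Σℚ-* xs u v = trans (Σℚ-cong xs (λ x → Σℚ-*ˡ xs (u x) v)) (Σℚ-*ʳ xs (Σℚ xs v) u)

Σℚ-concatMap : ∀ {A B : Set} (g : A → List B) (xs : List A) (f : B → ℚ) →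
               Σℚ (concatMap g xs) f ≡ Σℚ xs (λ x → Σℚ (g x) f)
Σℚ-concatMap g []       f = refl
Σℚ-concatMap g (x ∷ xs) f = trans (Σℚ-++ (g x) (concatMap g xs) f) (cong (Σℚ (g x) f +_) (Σℚ-concatMap g xs f))

Σℚ-swap : ∀ {A B : Set} (xs : List A) (ys : List B) (f : A → B → ℚ) →
          Σℚ xs (λ x → Σℚ ys (f x)) ≡ Σℚ ys (λ y → Σℚ xs (λ x → f x y))
Σℚ-swap []       ys f = sym (Σℚ-0 ys)
Σℚ-swap (x ∷ xs) ys f =
  trans (cong (Σℚ ys (f x) +_) (Σℚ-swap xs ys f)) (sym (Σℚ-+ ys (f x) (λ y → Σℚ xs (λ x' → f x' y))))

Σ<-applyUpTo : ∀ (g : ℕ → ℕ) n (f : ℕ → ℚ) → Σℚ (applyUpTo g n) f ≡ Σ< n (λ i → f (g i))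
Σ<-applyUpTo g zero    f = refl
Σ<-applyUpTo g (suc n) f = cong (f (g 0) +_)
  (trans (Σ<-applyUpTo (λ i → g (suc i)) n f) (sym (Σ<-applyUpTo suc n (λ i → f (g i)))))

Σ<-suc : ∀ n (f : ℕ → ℚ) → Σ< (suc n) f ≡ f 0 + Σ< n (λ i → f (suc i))
Σ<-suc n f = cong (f 0 +_) (Σ<-applyUpTo suc n f)

Σ<-snoc : ∀ n (f : ℕ → ℚ) → Σ< (suc n) f ≡ Σ< n f + f n
Σ<-snoc zero    f = trans (ℚP.+-identityʳ (f 0)) (sym (ℚP.+-identityˡ (f 0)))
Σ<-snoc (suc n) f = begin
    Σ< (suc (suc n)) f                            ≡⟨ Σ<-suc (suc n) f ⟩
    f 0 + Σ< (suc n) (λ i → f (suc i))            ≡⟨ cong (f 0 +_) (Σ<-snoc n (λ i → f (suc i))) ⟩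
    f 0 + (Σ< n (λ i → f (suc i)) + f (suc n))    ≡⟨ sym (ℚP.+-assoc (f 0) _ _) ⟩
    (f 0 + Σ< n (λ i → f (suc i))) + f (suc n)    ≡⟨ cong (_+ f (suc n)) (sym (Σ<-suc n f)) ⟩
    Σ< (suc n) f + f (suc n)                      ∎
  where open ≡-Reasoning

Σ<-cong : ∀ n {f g : ℕ → ℚ} → (∀ i → f i ≡ g i) → Σ< n f ≡ Σ< n g
Σ<-cong n = Σℚ-cong (upTo n)

Σℚ-Σℚ-Σ<-square : ∀ {A : Set} (xs : List A) K (u : ℕ → A → ℚ) →
  Σℚ xs (λ p → Σℚ xs (λ q → Σ< K (λ i → u i p * u i q))) ≡ Σ< K (λ i → Σℚ xs (u i) * Σℚ xs (u i))
Σℚ-Σℚ-Σ<-square xs K u = begin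
    Σℚ xs (λ p → Σℚ xs (λ q → Σ< K (λ i → u i p * u i q)))
      ≡⟨ Σℚ-cong xs (λ p → Σℚ-swap xs (upTo K) (λ q i → u i p * u i q)) ⟩
    Σℚ xs (λ p → Σ< K (λ i → Σℚ xs (λ q → u i p * u i q)))
      ≡⟨ Σℚ-swap xs (upTo K) (λ p i → Σℚ xs (λ q → u i p * u i q)) ⟩
    Σ< K (λ i → Σℚ xs (λ p → Σℚ xs (λ q → u i p * u i q)))
      ≡⟨ Σ<-cong K (λ i → Σℚ-Σℚ-* xs (u i) (u i)) ⟩
    Σ< K (λ i → Σℚ xs (u i) * Σℚ xs (u i)) ∎
  where open ≡-Reasoning

Σ<-parity : ∀ k (f : ℕ → ℚ) →
            Σ< (suc (k ℕ.+ k)) f ≡ f 0 + Σ< k (λ i → f (suc (i ℕ.+ i)) + f (suc (i ℕ.+ suc i)))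
Σ<-parity zero    f = refl
Σ<-parity (suc k) f = begin
    Σ< (suc (suc (k ℕ.+ suc k))) f
      ≡⟨ Σ<-snoc (suc (k ℕ.+ suc k)) f ⟩
    Σ< (suc (k ℕ.+ suc k)) f + f (suc (k ℕ.+ suc k))
      ≡⟨ cong (λ m → Σ< (suc m) f + f (suc (k ℕ.+ suc k))) (ℕP.+-suc k k) ⟩
    Σ< (suc (suc (k ℕ.+ k))) f + f (suc (k ℕ.+ suc k))
      ≡⟨ cong (_+ f (suc (k ℕ.+ suc k))) (Σ<-snoc (suc (k ℕ.+ k)) f) ⟩
    (Σ< (suc (k ℕ.+ k)) f + f (suc (k ℕ.+ k))) + f (suc (k ℕ.+ suc k))
      ≡⟨ cong (λ z → (z + f (suc (k ℕ.+ k))) + f (suc (k ℕ.+ suc k))) (Σ<-parity k f) ⟩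
    ((f 0 + Σ< k g) + f (suc (k ℕ.+ k))) + f (suc (k ℕ.+ suc k))
      ≡⟨ reassoc (f 0) (Σ< k g) (f (suc (k ℕ.+ k))) (f (suc (k ℕ.+ suc k))) ⟩
    f 0 + (Σ< k g + g k)
      ≡⟨ cong (f 0 +_) (sym (Σ<-snoc k g)) ⟩
    f 0 + Σ< (suc k) g ∎
  where
  open ≡-Reasoning
  g : ℕ → ℚ
  g i = f (suc (i ℕ.+ i)) + f (suc (i ℕ.+ suc i))
  reassoc : ∀ a S x y → ((a + S) + x) + y ≡ a + (S + (x + y))
  reassoc = ℚ-solve ℚ-ring

ι : Bool → ℚ
ι true  = 1ℚ
ι false = 0ℚ

if-then-0≡ι* : ∀ b x → (if b then x else 0ℚ) ≡ ι b * x
if-then-0≡ι* true  x = sym (ℚP.*-identityˡ x)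
if-then-0≡ι* false x = sym (ℚP.*-zeroˡ x)

δ : ℕ → ℕ → ℚ
δ zero    zero    = 1ℚ
δ zero    (suc h) = 0ℚ
δ (suc e) zero    = 0ℚ
δ (suc e) (suc h) = δ e h

δ-reflects : ∀ h i (f : ℕ → ℚ) → ι (h ℕ.≡ᵇ i) * f h ≡ δ i h * f i
δ-reflects zero    zero    f = refl
δ-reflects zero    (suc i) f = trans (ℚP.*-zeroˡ (f 0)) (sym (ℚP.*-zeroˡ (f (suc i))))
δ-reflects (suc h) zero    f = trans (ℚP.*-zeroˡ (f (suc h))) (sym (ℚP.*-zeroˡ (f 0)))
δ-reflects (suc h) (suc i) f = δ-reflects h i (λ x → f (suc x))

conv : (ℕ → ℚ) → (ℕ → ℚ) → ℕ → ℚ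
conv f g zero    = f 0 * g 0
conv f g (suc n) = f 0 * g (suc n) + conv (λ a → f (suc a)) g n

conv-cong : ∀ {f f' : ℕ → ℚ} (g : ℕ → ℚ) n → (∀ a → f a ≡ f' a) → conv f g n ≡ conv f' g n
conv-cong g zero    e = cong (_* g 0) (e 0)
conv-cong g (suc n) e = cong₂ _+_ (cong (_* g (suc n)) (e 0)) (conv-cong g n (λ a → e (suc a)))

conv-+ : ∀ (f f' g : ℕ → ℚ) n → conv (λ a → f a + f' a) g n ≡ conv f g n + conv f' g n
conv-+ f f' g zero    = ℚP.*-distribʳ-+ (g 0) (f 0) (f' 0)
conv-+ f f' g (suc n) = begin
    (f 0 + f' 0) * g (suc n) + conv (λ a → f (suc a) + f' (suc a)) g n
      ≡⟨ cong₂ _+_ (ℚP.*-distribʳ-+ (g (suc n)) (f 0) (f' 0)) (conv-+ (λ a → f (suc a)) (λ a → f' (suc a)) g n) ⟩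
    (f 0 * g (suc n) + f' 0 * g (suc n)) + (conv (λ a → f (suc a)) g n + conv (λ a → f' (suc a)) g n)
      ≡⟨ interchange (f 0 * g (suc n)) (f' 0 * g (suc n)) _ _ ⟩
    (f 0 * g (suc n) + conv (λ a → f (suc a)) g n) + (f' 0 * g (suc n) + conv (λ a → f' (suc a)) g n) ∎
  where
  open ≡-Reasoning
  interchange : ∀ a b c d → (a + b) + (c + d) ≡ (a + c) + (b + d)
  interchange = ℚ-solve ℚ-ring

conv-*ˡ : ∀ (c : ℚ) (f g : ℕ → ℚ) n → conv (λ a → c * f a) g n ≡ c * conv f g n
conv-*ˡ c f g zero    = ℚP.*-assoc c (f 0) (g 0)
conv-*ˡ c f g (suc n) = trans (cong₂ _+_ (ℚP.*-assoc c (f 0) (g (suc n))) (conv-*ˡ c (λ a → f (suc a)) g n))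
                              (sym (ℚP.*-distribˡ-+ c _ _))

conv-*ʳ : ∀ (c : ℚ) (f g : ℕ → ℚ) n → conv f (λ b → c * g b) n ≡ c * conv f g n
conv-*ʳ c f g zero    = swap c (f 0) (g 0)
  where
  swap : ∀ c a b → a * (c * b) ≡ c * (a * b)
  swap = ℚ-solve ℚ-ring
conv-*ʳ c f g (suc n) = trans (cong₂ _+_ (swap c (f 0) (g (suc n))) (conv-*ʳ c (λ a → f (suc a)) g n))
                              (sym (ℚP.*-distribˡ-+ c _ _))
  where
  swap : ∀ c a b → a * (c * b) ≡ c * (a * b)
  swap = ℚ-solve ℚ-ring

conv-linear : ∀ (α β : ℚ) (f₁ f₂ g : ℕ → ℚ) n →
              conv (λ a → α * f₁ a + β * f₂ a) g n ≡ α * conv f₁ g n + β * conv f₂ g n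
conv-linear α β f₁ f₂ g n =
  trans (conv-+ (λ a → α * f₁ a) (λ a → β * f₂ a) g n) (cong₂ _+_ (conv-*ˡ α f₁ g n) (conv-*ˡ β f₂ g n))

module Transfer (γ : ℚ) where

  T : (ℕ → ℚ) → ℕ → ℚ
  T v zero    = v 0 + γ * v 1
  T v (suc h) = v h + (1ℚ + γ) * v (suc h) + γ * v (suc (suc h))

  T-cong : ∀ {u v : ℕ → ℚ} → (∀ x → u x ≡ v x) → ∀ h → T u h ≡ T v h
  T-cong e zero    = cong₂ _+_ (e 0) (cong (γ *_) (e 1))
  T-cong e (suc h) = cong₂ _+_ (cong₂ _+_ (e h) (cong ((1ℚ + γ) *_) (e (suc h)))) (cong (γ *_) (e (suc (suc h))))

  T-+ : ∀ (u v : ℕ → ℚ) h → T (λ x → u x + v x) h ≡ T u h + T v h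
  T-+ u v zero = linear γ (u 0) (v 0) (u 1) (v 1)
    where
    linear : ∀ g a b a' b' → (a + b) + g * (a' + b') ≡ (a + g * a') + (b + g * b')
    linear = ℚ-solve ℚ-ring
  T-+ u v (suc h) = linear γ (u h) (v h) (u (suc h)) (v (suc h)) (u (suc (suc h))) (v (suc (suc h)))
    where
    linear : ∀ g a b a' b' a'' b'' → (a + b) + (1ℚ + g) * (a' + b') + g * (a'' + b'')
                                   ≡ (a + (1ℚ + g) * a' + g * a'') + (b + (1ℚ + g) * b' + g * b'')
    linear = ℚ-solve ℚ-ring

  T-*ˡ : ∀ (c : ℚ) (u : ℕ → ℚ) h → T (λ x → c * u x) h ≡ c * T u h
  T-*ˡ c u zero = linear γ c (u 0) (u 1)
    where
    linear : ∀ g c a b → c * a + g * (c * b) ≡ c * (a + g * b)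
    linear = ℚ-solve ℚ-ring
  T-*ˡ c u (suc h) = linear γ c (u h) (u (suc h)) (u (suc (suc h)))
    where
    linear : ∀ g c a b d → c * a + (1ℚ + g) * (c * b) + g * (c * d) ≡ c * (a + (1ℚ + g) * b + g * d)
    linear = ℚ-solve ℚ-ring

  T-*ʳ : ∀ (u : ℕ → ℚ) (c : ℚ) h → T (λ x → u x * c) h ≡ T u h * c
  T-*ʳ u c h = trans (T-cong (λ x → ℚP.*-comm (u x) c) h) (trans (T-*ˡ c u h) (ℚP.*-comm c (T u h)))

  T-0 : ∀ h → T (λ _ → 0ℚ) h ≡ 0ℚ
  T-0 h = trans (T-cong (λ _ → sym (ℚP.*-zeroˡ 0ℚ)) h) (trans (T-*ˡ 0ℚ (λ _ → 0ℚ) h) (ℚP.*-zeroˡ (T (λ _ → 0ℚ) h)))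

  T-linear : ∀ (α β : ℚ) (u v w : ℕ → ℚ) h →
             T (λ x → α * u x + β * v x + w x) h ≡ α * T u h + β * T v h + T w h
  T-linear α β u v w h = begin
      T (λ x → α * u x + β * v x + w x) h
        ≡⟨ T-+ (λ x → α * u x + β * v x) w h ⟩
      T (λ x → α * u x + β * v x) h + T w h
        ≡⟨ cong (_+ T w h) (T-+ (λ x → α * u x) (λ x → β * v x) h) ⟩
      T (λ x → α * u x) h + T (λ x → β * v x) h + T w h
        ≡⟨ cong₂ (λ a b → a + b + T w h) (T-*ˡ α u h) (T-*ˡ β v h) ⟩
      α * T u h + β * T v h + T w h ∎
    where open ≡-Reasoning

  T-conv : ∀ (G : ℕ → ℕ → ℚ) (B : ℕ → ℚ) n h → T (λ x → conv (λ a → G a x) B n) h ≡ conv (λ a → T (G a) h) B n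
  T-conv G B zero    h = T-*ʳ (G 0) (B 0) h
  T-conv G B (suc n) h = trans (T-+ (λ x → G 0 x * B (suc n)) (λ x → conv (λ a → G (suc a) x) B n) h)
    (cong₂ _+_ (T-*ʳ (G 0) (B (suc n)) h) (T-conv (λ a → G (suc a)) B n h))

  T-Σℚ : ∀ {B : Set} (xs : List B) (f : ℕ → B → ℚ) h →
         Σℚ xs (λ w → T (λ h' → f h' w) h) ≡ T (λ h' → Σℚ xs (f h')) h
  T-Σℚ xs f zero = trans (Σℚ-+ xs (f 0) (λ w → γ * f 1 w)) (cong (Σℚ xs (f 0) +_) (Σℚ-*ˡ xs γ (f 1)))
  T-Σℚ xs f (suc h) = trans (Σℚ-+ xs (λ w → f h w + (1ℚ + γ) * f (suc h) w) (λ w → γ * f (suc (suc h)) w))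
    (cong₂ _+_ (trans (Σℚ-+ xs (f h) (λ w → (1ℚ + γ) * f (suc h) w))
                      (cong (Σℚ xs (f h) +_) (Σℚ-*ˡ xs (1ℚ + γ) (f (suc h)))))
               (Σℚ-*ˡ xs γ (f (suc (suc h)))))

  kernel : ℕ → ℕ → ℕ → ℚ
  kernel zero    e = δ e
  kernel (suc a) e = T (kernel a e)

  pathSum : ℕ → ℕ → ℚ
  pathSum a = kernel a 0

  kernel-suc-zero : ∀ a h → kernel (suc a) 0 h ≡ kernel a 0 h + kernel a 1 h
  kernel-suc-zero zero zero = cong (1ℚ +_) (ℚP.*-zeroʳ γ)
  kernel-suc-zero zero (suc h) = simplify γ (δ 0 h)
    where
    simplify : ∀ g x → x + (1ℚ + g) * 0ℚ + g * 0ℚ ≡ 0ℚ + x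
    simplify = ℚ-solve ℚ-ring
  kernel-suc-zero (suc a) h = trans (T-cong (kernel-suc-zero a) h) (T-+ (kernel a 0) (kernel a 1) h)

  kernel-suc-suc : ∀ a e h → kernel (suc a) (suc e) h
                           ≡ γ * kernel a e h + (1ℚ + γ) * kernel a (suc e) h + kernel a (suc (suc e)) h
  kernel-suc-suc zero e zero = simplify γ (δ e 0)
    where
    simplify : ∀ g x → 0ℚ + g * x ≡ g * x + (1ℚ + g) * 0ℚ + 0ℚ
    simplify = ℚ-solve ℚ-ring
  kernel-suc-suc zero e (suc h) = reorder γ (δ (suc e) h) (δ e h) (δ e (suc h))
    where
    reorder : ∀ g x y z → x + (1ℚ + g) * y + g * z ≡ g * z + (1ℚ + g) * y + x
    reorder = ℚ-solve ℚ-ring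
  kernel-suc-suc (suc a) e h =
    trans (T-cong (kernel-suc-suc a e) h) (T-linear γ (1ℚ + γ) (kernel a e) (kernel a (suc e)) (kernel a (suc (suc e))) h)

  δ-reversible : ∀ e h → γ ^ h * δ e h ≡ γ ^ e * δ h e
  δ-reversible zero    zero    = refl
  δ-reversible zero    (suc h) = trans (ℚP.*-zeroʳ (γ ^ suc h)) (sym (ℚP.*-zeroʳ 1ℚ))
  δ-reversible (suc e) zero    = trans (ℚP.*-zeroʳ 1ℚ) (sym (ℚP.*-zeroʳ (γ ^ suc e)))
  δ-reversible (suc e) (suc h) = trans (ℚP.*-assoc γ (γ ^ h) (δ e h))
    (trans (cong (γ *_) (δ-reversible e h)) (sym (ℚP.*-assoc γ (γ ^ e) (δ h e))))

  kernel-reversible : ∀ a e h → γ ^ h * kernel a e h ≡ γ ^ e * kernel a h e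
  kernel-reversible zero e h = δ-reversible e h
  kernel-reversible (suc a) e zero = begin
      1ℚ * (K e 0 + γ * K e 1)                ≡⟨ expand γ (K e 0) (K e 1) ⟩
      1ℚ * K e 0 + (γ * 1ℚ) * K e 1           ≡⟨ cong₂ _+_ (kernel-reversible a e 0) (kernel-reversible a e 1) ⟩
      γ ^ e * K 0 e + γ ^ e * K 1 e           ≡⟨ sym (ℚP.*-distribˡ-+ (γ ^ e) _ _) ⟩
      γ ^ e * (K 0 e + K 1 e)                 ≡⟨ cong (γ ^ e *_) (sym (kernel-suc-zero a e)) ⟩
      γ ^ e * kernel (suc a) 0 e              ∎
    where
    open ≡-Reasoning
    K = kernel a
    expand : ∀ g x y → 1ℚ * (x + g * y) ≡ 1ℚ * x + (g * 1ℚ) * y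
    expand = ℚ-solve ℚ-ring
  kernel-reversible (suc a) e (suc h) = begin
      (γ * γ ^ h) * (K e h + (1ℚ + γ) * K e (suc h) + γ * K e (suc (suc h)))
        ≡⟨ expand γ (γ ^ h) (K e h) (K e (suc h)) (K e (suc (suc h))) ⟩
      γ * (γ ^ h * K e h) + (1ℚ + γ) * (γ ^ suc h * K e (suc h)) + γ ^ suc (suc h) * K e (suc (suc h))
        ≡⟨ cong₂ _+_ (cong₂ _+_ (cong (γ *_) (kernel-reversible a e h))
                                (cong ((1ℚ + γ) *_) (kernel-reversible a e (suc h))))
                     (kernel-reversible a e (suc (suc h))) ⟩
      γ * (γ ^ e * K h e) + (1ℚ + γ) * (γ ^ e * K (suc h) e) + γ ^ e * K (suc (suc h)) e
        ≡⟨ collect γ (γ ^ e) (K h e) (K (suc h) e) (K (suc (suc h)) e) ⟩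
      γ ^ e * (γ * K h e + (1ℚ + γ) * K (suc h) e + K (suc (suc h)) e)
        ≡⟨ cong (γ ^ e *_) (sym (kernel-suc-suc a h e)) ⟩
      γ ^ e * kernel (suc a) (suc h) e ∎
    where
    open ≡-Reasoning
    K = kernel a
    expand : ∀ g p x y z → (g * p) * (x + (1ℚ + g) * y + g * z)
                         ≡ g * (p * x) + (1ℚ + g) * ((g * p) * y) + (g * (g * p)) * z
    expand = ℚ-solve ℚ-ring
    collect : ∀ g q x y z → g * (q * x) + (1ℚ + g) * (q * y) + q * z ≡ q * (g * x + (1ℚ + g) * y + z)
    collect = ℚ-solve ℚ-ring

  kernel-at-0 : ∀ a e → kernel a e 0 ≡ γ ^ e * pathSum a e
  kernel-at-0 a e = trans (sym (ℚP.*-identityˡ (kernel a e 0))) (kernel-reversible a e 0)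

  pathSum-vanishes : ∀ a h → a ℕ.< h → pathSum a h ≡ 0ℚ
  pathSum-vanishes zero    (suc h) _         = refl
  pathSum-vanishes (suc a) (suc h) (s≤s a<h) = begin
      pathSum a h + (1ℚ + γ) * pathSum a (suc h) + γ * pathSum a (suc (suc h))
        ≡⟨ cong₂ _+_ (cong₂ _+_ (pathSum-vanishes a h a<h)
                                (cong ((1ℚ + γ) *_) (pathSum-vanishes a (suc h) (ℕP.m<n⇒m<1+n a<h))))
                     (cong (γ *_) (pathSum-vanishes a (suc (suc h)) (ℕP.m<n⇒m<1+n (ℕP.m<n⇒m<1+n a<h)))) ⟩
      0ℚ + (1ℚ + γ) * 0ℚ + γ * 0ℚ
        ≡⟨ simplify γ ⟩
      0ℚ ∎
    where
    open ≡-Reasoning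
    simplify : ∀ g → 0ℚ + (1ℚ + g) * 0ℚ + g * 0ℚ ≡ 0ℚ
    simplify = ℚ-solve ℚ-ring

  pathSum⁺ : ℕ → ℕ → ℚ
  pathSum⁺ a i = pathSum a i + γ * pathSum a (suc i)

  pathSum⁺-suc-zero : ∀ a → pathSum⁺ (suc a) 0 ≡ (1ℚ + γ) * pathSum⁺ a 0 + γ * pathSum⁺ a 1
  pathSum⁺-suc-zero a = expand γ (pathSum a 0) (pathSum a 1) (pathSum a 2)
    where
    expand : ∀ g x y z → (x + g * y) + g * (x + (1ℚ + g) * y + g * z) ≡ (1ℚ + g) * (x + g * y) + g * (y + g * z)
    expand = ℚ-solve ℚ-ring

  pathSum⁺-suc-suc : ∀ a i → pathSum⁺ (suc a) (suc i)
                           ≡ γ * pathSum⁺ a (suc (suc i)) + (1ℚ + γ) * pathSum⁺ a (suc i) + pathSum⁺ a i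
  pathSum⁺-suc-suc a i = expand γ (pathSum a i) (pathSum a (suc i)) (pathSum a (suc (suc i))) (pathSum a (suc (suc (suc i))))
    where
    expand : ∀ g x y z w → (x + (1ℚ + g) * y + g * z) + g * (y + (1ℚ + g) * z + g * w)
                         ≡ g * (z + g * w) + (1ℚ + g) * (y + g * z) + (x + g * y)
    expand = ℚ-solve ℚ-ring

  pathSum-conv : ∀ n i j → pathSum (suc n) (suc (i ℕ.+ j)) ≡ conv (λ a → pathSum⁺ a i) (λ b → pathSum b j) n
  pathSum-conv zero zero j = simplify γ (δ 0 j)
    where
    simplify : ∀ g x → x + (1ℚ + g) * 0ℚ + g * 0ℚ ≡ (1ℚ + g * 0ℚ) * x
    simplify = ℚ-solve ℚ-ring
  pathSum-conv zero (suc i) j = simplify γ (δ 0 j)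
    where
    simplify : ∀ g x → 0ℚ + (1ℚ + g) * 0ℚ + g * 0ℚ ≡ (0ℚ + g * 0ℚ) * x
    simplify = ℚ-solve ℚ-ring
  pathSum-conv (suc n) zero j = begin
      P j + (1ℚ + γ) * P (suc j) + γ * P (suc (suc j))
        ≡⟨ regroup γ (P j) (P (suc j)) (P (suc (suc j))) ⟩
      (1ℚ + γ * 0ℚ) * P j + ((1ℚ + γ) * P (suc j) + γ * P (suc (suc j)))
        ≡⟨ cong ((1ℚ + γ * 0ℚ) * P j +_) tail ⟩
      (1ℚ + γ * 0ℚ) * P j + conv (λ a → pathSum⁺ (suc a) 0) B n ∎
    where
    open ≡-Reasoning
    P = pathSum (suc n)
    B = λ b → pathSum b j
    regroup : ∀ g x y z → x + (1ℚ + g) * y + g * z ≡ (1ℚ + g * 0ℚ) * x + ((1ℚ + g) * y + g * z)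
    regroup = ℚ-solve ℚ-ring
    tail : (1ℚ + γ) * P (suc j) + γ * P (suc (suc j)) ≡ conv (λ a → pathSum⁺ (suc a) 0) B n
    tail = begin
        (1ℚ + γ) * P (suc j) + γ * P (suc (suc j))
          ≡⟨ cong₂ (λ x y → (1ℚ + γ) * x + γ * y) (pathSum-conv n 0 j) (pathSum-conv n 1 j) ⟩
        (1ℚ + γ) * conv (λ a → pathSum⁺ a 0) B n + γ * conv (λ a → pathSum⁺ a 1) B n
          ≡⟨ sym (conv-linear (1ℚ + γ) γ (λ a → pathSum⁺ a 0) (λ a → pathSum⁺ a 1) B n) ⟩
        conv (λ a → (1ℚ + γ) * pathSum⁺ a 0 + γ * pathSum⁺ a 1) B n
          ≡⟨ conv-cong B n (λ a → sym (pathSum⁺-suc-zero a)) ⟩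
        conv (λ a → pathSum⁺ (suc a) 0) B n ∎
  pathSum-conv (suc n) (suc i) j = begin
      P t + (1ℚ + γ) * P (suc t) + γ * P (suc (suc t))
        ≡⟨ regroup γ (P t) (P (suc t)) (P (suc (suc t))) (P j) ⟩
      (0ℚ + γ * 0ℚ) * P j + (γ * P (suc (suc t)) + (1ℚ + γ) * P (suc t) + P t)
        ≡⟨ cong ((0ℚ + γ * 0ℚ) * P j +_) tail ⟩
      (0ℚ + γ * 0ℚ) * P j + conv (λ a → pathSum⁺ (suc a) (suc i)) B n ∎
    where
    open ≡-Reasoning
    P = pathSum (suc n)
    B = λ b → pathSum b j
    t = suc (i ℕ.+ j)
    f₀ f₁ f₂ : ℕ → ℚ
    f₀ a = pathSum⁺ a i
    f₁ a = pathSum⁺ a (suc i)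
    f₂ a = pathSum⁺ a (suc (suc i))
    regroup : ∀ g x y z w → x + (1ℚ + g) * y + g * z ≡ (0ℚ + g * 0ℚ) * w + (g * z + (1ℚ + g) * y + x)
    regroup = ℚ-solve ℚ-ring
    tail : γ * P (suc (suc t)) + (1ℚ + γ) * P (suc t) + P t ≡ conv (λ a → pathSum⁺ (suc a) (suc i)) B n
    tail = begin
        γ * P (suc (suc t)) + (1ℚ + γ) * P (suc t) + P t
          ≡⟨ cong₂ _+_ (cong₂ (λ x y → γ * x + (1ℚ + γ) * y) (pathSum-conv n (suc (suc i)) j) (pathSum-conv n (suc i) j))
                       (pathSum-conv n i j) ⟩
        γ * conv f₂ B n + (1ℚ + γ) * conv f₁ B n + conv f₀ B n
          ≡⟨ cong (_+ conv f₀ B n) (sym (conv-linear γ (1ℚ + γ) f₂ f₁ B n)) ⟩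
        conv (λ a → γ * f₂ a + (1ℚ + γ) * f₁ a) B n + conv f₀ B n
          ≡⟨ sym (conv-+ (λ a → γ * f₂ a + (1ℚ + γ) * f₁ a) f₀ B n) ⟩
        conv (λ a → γ * f₂ a + (1ℚ + γ) * f₁ a + f₀ a) B n
          ≡⟨ conv-cong B n (λ a → sym (pathSum⁺-suc-suc a i)) ⟩
        conv (λ a → pathSum⁺ (suc a) (suc i)) B n ∎

  T-self-adjoint : ∀ (u v : ℕ → ℚ) M →
    Σ< (suc M) (λ h → γ ^ h * (T u h * v h))
      ≡ Σ< (suc M) (λ h → γ ^ h * (u h * T v h)) + γ ^ suc M * (u (suc M) * v M - u M * v (suc M))
  T-self-adjoint u v zero = expand γ (u 0) (u 1) (v 0) (v 1)
    where
    expand : ∀ g a b c d → 1ℚ * ((a + g * b) * c) + 0ℚ ≡ (1ℚ * (a * (c + g * d)) + 0ℚ) + (g * 1ℚ) * (b * c - a * d)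
    expand = ℚ-solve ℚ-ring
  T-self-adjoint u v (suc M) = begin
      Σ< (suc (suc M)) F
        ≡⟨ Σ<-snoc (suc M) F ⟩
      Σ< (suc M) F + F (suc M)
        ≡⟨ cong (_+ F (suc M)) (T-self-adjoint u v M) ⟩
      (Σ< (suc M) G + γ ^ suc M * (u (suc M) * v M - u M * v (suc M))) + F (suc M)
        ≡⟨ telescope γ (γ ^ suc M) (Σ< (suc M) G) (u M) (u (suc M)) (u (suc (suc M))) (v M) (v (suc M)) (v (suc (suc M))) ⟩
      (Σ< (suc M) G + G (suc M)) + γ ^ suc (suc M) * (u (suc (suc M)) * v (suc M) - u (suc M) * v (suc (suc M)))
        ≡⟨ cong (_+ γ ^ suc (suc M) * (u (suc (suc M)) * v (suc M) - u (suc M) * v (suc (suc M)))) (sym (Σ<-snoc (suc M) G)) ⟩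
      Σ< (suc (suc M)) G + γ ^ suc (suc M) * (u (suc (suc M)) * v (suc M) - u (suc M) * v (suc (suc M))) ∎
    where
    open ≡-Reasoning
    F G : ℕ → ℚ
    F h = γ ^ h * (T u h * v h)
    G h = γ ^ h * (u h * T v h)
    telescope : ∀ g p S a0 a1 a2 b0 b1 b2 →
      (S + p * (a1 * b0 - a0 * b1)) + p * ((a0 + (1ℚ + g) * a1 + g * a2) * b1)
      ≡ (S + p * (a1 * (b0 + (1ℚ + g) * b1 + g * b2))) + (g * p) * (a2 * b1 - a1 * b2)
    telescope = ℚ-solve ℚ-ring

  pairing : ℕ → ℕ → ℕ → ℚ
  pairing M m n = Σ< (suc M) (λ h → γ ^ h * (pathSum m h * pathSum n h))

  pairing-step : ∀ M m n → m ℕ.≤ M → n ℕ.≤ M → pairing M (suc m) n ≡ pairing M m (suc n)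
  pairing-step M m n m≤M n≤M = begin
      pairing M (suc m) n
        ≡⟨ T-self-adjoint (pathSum m) (pathSum n) M ⟩
      pairing M m (suc n) + γ ^ suc M * (pathSum m (suc M) * pathSum n M - pathSum m M * pathSum n (suc M))
        ≡⟨ cong₂ (λ x y → pairing M m (suc n) + γ ^ suc M * (x * pathSum n M - pathSum m M * y))
                 (pathSum-vanishes m (suc M) (s≤s m≤M)) (pathSum-vanishes n (suc M) (s≤s n≤M)) ⟩
      pairing M m (suc n) + γ ^ suc M * (0ℚ * pathSum n M - pathSum m M * 0ℚ)
        ≡⟨ simplify (pairing M m (suc n)) (γ ^ suc M) (pathSum n M) (pathSum m M) ⟩
      pairing M m (suc n) ∎
    where
    open ≡-Reasoning
    simplify : ∀ q p x y → q + p * (0ℚ * x - y * 0ℚ) ≡ q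
    simplify = ℚ-solve ℚ-ring

  pairing-shift : ∀ M s m n → m ℕ.+ s ℕ.+ n ℕ.≤ M → pairing M (m ℕ.+ s) n ≡ pairing M m (n ℕ.+ s)
  pairing-shift M zero m n _ = cong₂ (pairing M) (ℕP.+-identityʳ m) (sym (ℕP.+-identityʳ n))
  pairing-shift M (suc s) m n le = begin
      pairing M (m ℕ.+ suc s) n     ≡⟨ cong (λ z → pairing M z n) (ℕP.+-suc m s) ⟩
      pairing M (suc m ℕ.+ s) n     ≡⟨ pairing-shift M s (suc m) n (ℕP.≤-trans (ℕP.≤-reflexive (sym (shuffle₁ m s n))) le) ⟩
      pairing M (suc m) (n ℕ.+ s)   ≡⟨ pairing-step M m (n ℕ.+ s) (ℕP.≤-trans (ℕP.m≤m+n m _) le')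
                                                                 (ℕP.≤-trans (ℕP.m≤m+n (n ℕ.+ s) _) le'') ⟩
      pairing M m (suc (n ℕ.+ s))   ≡⟨ cong (pairing M m) (sym (ℕP.+-suc n s)) ⟩
      pairing M m (n ℕ.+ suc s)     ∎
    where
    open ≡-Reasoning
    shuffle₁ : ∀ m s n → m ℕ.+ suc s ℕ.+ n ≡ suc m ℕ.+ s ℕ.+ n
    shuffle₁ = ℕ-Solver.solve-∀
    shuffle₂ : ∀ m s n → m ℕ.+ suc s ℕ.+ n ≡ m ℕ.+ (suc s ℕ.+ n)
    shuffle₂ = ℕ-Solver.solve-∀
    shuffle₃ : ∀ m s n → m ℕ.+ suc s ℕ.+ n ≡ (n ℕ.+ s) ℕ.+ suc m
    shuffle₃ = ℕ-Solver.solve-∀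
    le' : m ℕ.+ (suc s ℕ.+ n) ℕ.≤ M
    le' = ℕP.≤-trans (ℕP.≤-reflexive (sym (shuffle₂ m s n))) le
    le'' : (n ℕ.+ s) ℕ.+ suc m ℕ.≤ M
    le'' = ℕP.≤-trans (ℕP.≤-reflexive (sym (shuffle₃ m s n))) le

  pairing-zero : ∀ M n → pairing M 0 n ≡ pathSum n 0
  pairing-zero M n = begin
      Σ< (suc M) (λ h → γ ^ h * (pathSum 0 h * pathSum n h))
        ≡⟨ Σ<-suc M (λ h → γ ^ h * (pathSum 0 h * pathSum n h)) ⟩
      1ℚ * (1ℚ * pathSum n 0) + Σ< M (λ h → γ ^ suc h * (0ℚ * pathSum n (suc h)))
        ≡⟨ cong (1ℚ * (1ℚ * pathSum n 0) +_) (trans (Σ<-cong M (λ h → vanish (γ ^ suc h) (pathSum n (suc h)))) (Σℚ-0 (upTo M))) ⟩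
      1ℚ * (1ℚ * pathSum n 0) + 0ℚ
        ≡⟨ simplify (pathSum n 0) ⟩
      pathSum n 0 ∎
    where
    open ≡-Reasoning
    vanish : ∀ p x → p * (0ℚ * x) ≡ 0ℚ
    vanish = ℚ-solve ℚ-ring
    simplify : ∀ x → 1ℚ * (1ℚ * x) + 0ℚ ≡ x
    simplify = ℚ-solve ℚ-ring

  Σγ^h*pathSum²≡pathSum : ∀ k → Σ< (suc (k ℕ.+ k)) (λ h → γ ^ h * (pathSum k h * pathSum k h)) ≡ pathSum (k ℕ.+ k) 0
  Σγ^h*pathSum²≡pathSum k = trans (pairing-shift (k ℕ.+ k) k 0 k ℕP.≤-refl) (pairing-zero (k ℕ.+ k) (k ℕ.+ k))

  module _ (i : ℕ) (B : ℕ → ℚ) where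

    source : ℕ → ℕ → ℚ
    source n h = (δ i h + δ (suc i) h) * B n

    kernel-pair : ℕ → ℕ → ℚ
    kernel-pair a h = kernel a i h + kernel a (suc i) h

    duhamel : ∀ (P : ℕ → ℕ → ℚ) → (∀ h → P 0 h ≡ 0ℚ) → (∀ n h → P (suc n) h ≡ T (P n) h + source n h) →
              ∀ n h → P (suc n) h ≡ conv (λ a → kernel-pair a h) B n
    duhamel P P₀ P-step zero h = begin
        P 1 h                      ≡⟨ P-step 0 h ⟩
        T (P 0) h + source 0 h     ≡⟨ cong (_+ source 0 h) (trans (T-cong P₀ h) (T-0 h)) ⟩
        0ℚ + source 0 h            ≡⟨ ℚP.+-identityˡ _ ⟩
        source 0 h                 ∎
      where open ≡-Reasoning
    duhamel P P₀ P-step (suc n) h = begin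
        P (suc (suc n)) h
          ≡⟨ P-step (suc n) h ⟩
        T (P (suc n)) h + source (suc n) h
          ≡⟨ cong (_+ source (suc n) h) (T-cong (duhamel P P₀ P-step n) h) ⟩
        T (λ x → conv (λ a → kernel-pair a x) B n) h + source (suc n) h
          ≡⟨ cong (_+ source (suc n) h) (T-conv kernel-pair B n h) ⟩
        conv (λ a → T (kernel-pair a) h) B n + source (suc n) h
          ≡⟨ cong (_+ source (suc n) h) (conv-cong B n (λ a → T-+ (kernel a i) (kernel a (suc i)) h)) ⟩
        conv (λ a → kernel-pair (suc a) h) B n + source (suc n) h
          ≡⟨ ℚP.+-comm _ (source (suc n) h) ⟩
        conv (λ a → kernel-pair a h) B (suc n) ∎
      where open ≡-Reasoning

    conv-kernel-pair-at-0 : ∀ n → conv (λ a → kernel-pair a 0) B n ≡ γ ^ i * conv (λ a → pathSum⁺ a i) B n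
    conv-kernel-pair-at-0 n =
      trans (conv-cong B n (λ a → trans (cong₂ _+_ (kernel-at-0 a i) (kernel-at-0 a (suc i)))
                                          (factor γ (γ ^ i) (pathSum a i) (pathSum a (suc i)))))
            (conv-*ˡ (γ ^ i) (λ a → pathSum⁺ a i) B n)
      where
      factor : ∀ g q x y → q * x + (g * q) * y ≡ q * (x + g * y)
      factor = ℚ-solve ℚ-ring

double : ℕ → ℕ
double zero    = 0
double (suc n) = suc (suc (double n))

double≡2* : ∀ n → double n ≡ 2 ℕ.* n
double≡2* zero    = refl
double≡2* (suc n) = trans (cong (λ z → suc (suc z)) (double≡2* n)) (2+2*n≡2*[1+n] n)
  where
  2+2*n≡2*[1+n] : ∀ n → suc (suc (2 ℕ.* n)) ≡ 2 ℕ.* suc n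
  2+2*n≡2*[1+n] = ℕ-Solver.solve-∀

altCheck-+2 : ∀ j h w → altCheck (suc (suc j)) h w ≡ altCheck j h w
altCheck-+2 j zero    []          = refl
altCheck-+2 j (suc h) []          = refl
altCheck-+2 j zero    (rise ∷ w)  = cong (isEven j ∧_) (altCheck-+2 (suc j) 1 w)
altCheck-+2 j (suc h) (rise ∷ w)  = cong (isEven j ∧_) (altCheck-+2 (suc j) (suc (suc h)) w)
altCheck-+2 j zero    (fall ∷ w)  = refl
altCheck-+2 j (suc h) (fall ∷ w)  = cong (isOdd j ∧_) (altCheck-+2 (suc j) h w)
altCheck-+2 j zero    (level ∷ w) = altCheck-+2 (suc j) zero w
altCheck-+2 j (suc h) (level ∷ w) = altCheck-+2 (suc j) (suc h) w

altCheck-2-rise : ∀ h w → altCheck 2 h (rise ∷ w) ≡ altCheck 1 (suc h) w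
altCheck-2-rise zero    w = altCheck-+2 1 1 w
altCheck-2-rise (suc h) w = altCheck-+2 1 (suc (suc h)) w

altCheck-2-level : ∀ h w → altCheck 2 h (level ∷ w) ≡ altCheck 1 h w
altCheck-2-level zero    w = altCheck-+2 1 0 w
altCheck-2-level (suc h) w = altCheck-+2 1 (suc h) w

altCheck-2-fall : ∀ h w → altCheck 2 h (fall ∷ w) ≡ false
altCheck-2-fall zero    w = refl
altCheck-2-fall (suc h) w = refl

Lgo-+2 : ∀ i j h w → Lgo i (suc (suc j)) h w ≡ Lgo i j h w
Lgo-+2 i j h []          = refl
Lgo-+2 i j h (rise ∷ w)  = Lgo-+2 i (suc j) (suc h) w
Lgo-+2 i j h (fall ∷ w)  = Lgo-+2 i (suc j) (h ∸ 1) w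
Lgo-+2 i j h (level ∷ w) with isEven j ∧ (h ℕ.≡ᵇ i)
... | true  = cong suc (Lgo-+2 i (suc j) h w)
... | false = Lgo-+2 i (suc j) h w

Rgo-rise : ∀ i h w → fromℕ (Rgo i h (rise ∷ w)) ≡ ι (h ℕ.≡ᵇ i) + fromℕ (Rgo i (suc h) w)
Rgo-rise i h w with h ℕ.≡ᵇ i
... | true  = fromℕ-suc (Rgo i (suc h) w)
... | false = sym (ℚP.+-identityˡ (fromℕ (Rgo i (suc h) w)))

Lgo-2-level : ∀ i h w → fromℕ (Lgo i 2 h (level ∷ w)) ≡ ι (h ℕ.≡ᵇ i) + fromℕ (Lgo i 1 h w)
Lgo-2-level i h w with h ℕ.≡ᵇ i
... | true  = trans (fromℕ-suc (Lgo i 3 h w)) (cong (λ z → 1ℚ + fromℕ z) (Lgo-+2 i 1 h w))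
... | false = trans (cong fromℕ (Lgo-+2 i 1 h w)) (sym (ℚP.+-identityˡ (fromℕ (Lgo i 1 h w))))

pairSum : (List Step → ℚ) → List Step → ℚ
pairSum F w = (F (rise ∷ rise ∷ w) + (F (fall ∷ rise ∷ w) + (F (level ∷ rise ∷ w) + 0ℚ)))
            + ((F (rise ∷ fall ∷ w) + (F (fall ∷ fall ∷ w) + (F (level ∷ fall ∷ w) + 0ℚ)))
            + ((F (rise ∷ level ∷ w) + (F (fall ∷ level ∷ w) + (F (level ∷ level ∷ w) + 0ℚ))) + 0ℚ))

Σℚ-words-+2 : ∀ m (F : List Step → ℚ) → Σℚ (words (suc (suc m))) F ≡ Σℚ (words m) (pairSum F)
Σℚ-words-+2 m F = trans (Σℚ-concatMap extend (words (suc m)) F) (Σℚ-concatMap extend (words m) (λ w → Σℚ (extend w) F))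
  where
  extend : List Step → List (List Step)
  extend w = (rise ∷ w) ∷ (fall ∷ w) ∷ (level ∷ w) ∷ []

-- Only the pairs (level, level), (level, rise), (fall, level), (fall, rise) are alternating.
pairSum-alternating-0 : ∀ (v : List Step → ℚ) w →
  pairSum (λ x → ι (altCheck 1 0 x) * v x) w
    ≡ ι (altCheck 1 1 w) * v (level ∷ rise ∷ w) + ι (altCheck 1 0 w) * v (level ∷ level ∷ w)
pairSum-alternating-0 v w rewrite altCheck-+2 1 1 w | altCheck-+2 1 0 w =
  collect (v (rise ∷ rise ∷ w)) (v (fall ∷ rise ∷ w)) (v (rise ∷ fall ∷ w)) (v (fall ∷ fall ∷ w))
          (v (level ∷ fall ∷ w)) (v (rise ∷ level ∷ w)) (v (fall ∷ level ∷ w))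
          (ι (altCheck 1 1 w) * v (level ∷ rise ∷ w)) (ι (altCheck 1 0 w) * v (level ∷ level ∷ w))
  where
  collect : ∀ a b c d e f g x y → (0ℚ * a + (0ℚ * b + (x + 0ℚ))) + ((0ℚ * c + (0ℚ * d + (0ℚ * e + 0ℚ)))
                                  + ((0ℚ * f + (0ℚ * g + (y + 0ℚ))) + 0ℚ)) ≡ x + y
  collect = ℚ-solve ℚ-ring

pairSum-alternating-suc : ∀ h (v : List Step → ℚ) w →
  pairSum (λ x → ι (altCheck 1 (suc h) x) * v x) w
    ≡ ι (altCheck 1 (suc (suc h)) w) * v (level ∷ rise ∷ w) + ι (altCheck 1 (suc h) w) * v (fall ∷ rise ∷ w)
      + ι (altCheck 1 h w) * v (fall ∷ level ∷ w) + ι (altCheck 1 (suc h) w) * v (level ∷ level ∷ w)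
pairSum-alternating-suc h v w rewrite altCheck-2-fall h w
                                    | altCheck-+2 1 (suc (suc h)) w | altCheck-2-rise h w
                                    | altCheck-2-level h w | altCheck-+2 1 (suc h) w =
  collect (v (rise ∷ rise ∷ w)) (v (rise ∷ fall ∷ w)) (v (fall ∷ fall ∷ w)) (v (level ∷ fall ∷ w)) (v (rise ∷ level ∷ w))
          (ι (altCheck 1 (suc (suc h)) w) * v (level ∷ rise ∷ w)) (ι (altCheck 1 (suc h) w) * v (fall ∷ rise ∷ w))
          (ι (altCheck 1 h w) * v (fall ∷ level ∷ w)) (ι (altCheck 1 (suc h) w) * v (level ∷ level ∷ w))
  where
  collect : ∀ a c d e f x y z u → (0ℚ * a + (y + (x + 0ℚ))) + ((0ℚ * c + (0ℚ * d + (0ℚ * e + 0ℚ)))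
                                  + ((0ℚ * f + (z + (u + 0ℚ))) + 0ℚ)) ≡ x + y + z + u
  collect = ℚ-solve ℚ-ring

module PathSums (γ : ℚ) where
  open Transfer γ

  Σℚ-words-T : ∀ m h (F : List Step → ℚ) (f : ℕ → List Step → ℚ) (g : List Step → ℚ) →
               (∀ w → pairSum F w ≡ T (λ h' → f h' w) h + g w) →
               Σℚ (words (suc (suc m))) F ≡ T (λ h' → Σℚ (words m) (f h')) h + Σℚ (words m) g
  Σℚ-words-T m h F f g pairSum-F = begin
      Σℚ (words (suc (suc m))) F                                     ≡⟨ Σℚ-words-+2 m F ⟩
      Σℚ (words m) (pairSum F)                                       ≡⟨ Σℚ-cong (words m) pairSum-F ⟩
      Σℚ (words m) (λ w → T (λ h' → f h' w) h + g w)                 ≡⟨ Σℚ-+ (words m) (λ w → T (λ h' → f h' w) h) g ⟩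
      Σℚ (words m) (λ w → T (λ h' → f h' w) h) + Σℚ (words m) g      ≡⟨ cong (_+ Σℚ (words m) g) (T-Σℚ (words m) f h) ⟩
      T (λ h' → Σℚ (words m) (f h')) h + Σℚ (words m) g              ∎
    where open ≡-Reasoning

  weight : ℕ → List Step → ℚ
  weight h w = ι (altCheck 1 h w) * γ ^ rises w

  pairSum-weight : ∀ h w → pairSum (weight h) w ≡ T (λ h' → weight h' w) h + 0ℚ
  pairSum-weight zero w = trans (pairSum-alternating-0 (λ x → γ ^ rises x) w) (regroup γ p (ι (altCheck 1 1 w)) (ι (altCheck 1 0 w)))
    where
    p = γ ^ rises w
    regroup : ∀ g p x y → x * (g * p) + y * p ≡ (y * p + g * (x * p)) + 0ℚ
    regroup = ℚ-solve ℚ-ring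
  pairSum-weight (suc h) w = trans (pairSum-alternating-suc h (λ x → γ ^ rises x) w)
    (regroup γ p (ι (altCheck 1 (suc (suc h)) w)) (ι (altCheck 1 (suc h) w)) (ι (altCheck 1 h w)))
    where
    p = γ ^ rises w
    regroup : ∀ g p c b a → c * (g * p) + b * (g * p) + a * p + b * p ≡ (a * p + (1ℚ + g) * (b * p) + g * (c * p)) + 0ℚ
    regroup = ℚ-solve ℚ-ring

  Σweight≡pathSum : ∀ n h → Σℚ (words (double n)) (weight h) ≡ pathSum n h
  Σweight≡pathSum zero    zero    = refl
  Σweight≡pathSum zero    (suc h) = refl
  Σweight≡pathSum (suc n) h = begin
      Σℚ (words (suc (suc (double n)))) (weight h)
        ≡⟨ Σℚ-words-T (double n) h (weight h) weight (λ _ → 0ℚ) (pairSum-weight h) ⟩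
      T (λ h' → Σℚ (words (double n)) (weight h')) h + Σℚ (words (double n)) (λ _ → 0ℚ)
        ≡⟨ cong₂ _+_ (T-cong (Σweight≡pathSum n) h) (Σℚ-0 (words (double n))) ⟩
      T (pathSum n) h + 0ℚ
        ≡⟨ ℚP.+-identityʳ _ ⟩
      pathSum (suc n) h ∎
    where open ≡-Reasoning

  module _ (i : ℕ) where

    weightR weightL : ℕ → List Step → ℚ
    weightR h w = ι (altCheck 1 h w) * (γ ^ rises w * fromℕ (Rgo i h w))
    weightL h w = ι (altCheck 1 h w) * (γ ^ rises w * fromℕ (Lgo i 1 h w))

    -- The first pair of steps from altitude h can contribute to R i or L i only if h = i or h = i + 1.
    atLevel : (ℕ → List Step → ℚ) → ℕ → List Step → ℚ
    atLevel f zero    w = ι (0 ℕ.≡ᵇ i) * f 0 w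
    atLevel f (suc h) w = ι (suc h ℕ.≡ᵇ i) * f (suc h) w + ι (h ℕ.≡ᵇ i) * f h w

    Σℚ-atLevel : ∀ (xs : List (List Step)) (f : ℕ → List Step → ℚ) (F : ℕ → ℚ) → (∀ h → Σℚ xs (f h) ≡ F h) →
                 ∀ h → Σℚ xs (atLevel f h) ≡ (δ i h + δ (suc i) h) * F i
    Σℚ-atLevel xs f F Σf zero = begin
        Σℚ xs (λ w → ι (0 ℕ.≡ᵇ i) * f 0 w)   ≡⟨ Σℚ-*ˡ xs (ι (0 ℕ.≡ᵇ i)) (f 0) ⟩
        ι (0 ℕ.≡ᵇ i) * Σℚ xs (f 0)           ≡⟨ cong (ι (0 ℕ.≡ᵇ i) *_) (Σf 0) ⟩
        ι (0 ℕ.≡ᵇ i) * F 0                   ≡⟨ δ-reflects 0 i F ⟩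
        δ i 0 * F i                          ≡⟨ cong (_* F i) (sym (ℚP.+-identityʳ (δ i 0))) ⟩
        (δ i 0 + δ (suc i) 0) * F i          ∎
      where open ≡-Reasoning
    Σℚ-atLevel xs f F Σf (suc h) = begin
        Σℚ xs (λ w → ι (suc h ℕ.≡ᵇ i) * f (suc h) w + ι (h ℕ.≡ᵇ i) * f h w)
          ≡⟨ Σℚ-+ xs (λ w → ι (suc h ℕ.≡ᵇ i) * f (suc h) w) (λ w → ι (h ℕ.≡ᵇ i) * f h w) ⟩
        Σℚ xs (λ w → ι (suc h ℕ.≡ᵇ i) * f (suc h) w) + Σℚ xs (λ w → ι (h ℕ.≡ᵇ i) * f h w)
          ≡⟨ cong₂ _+_ (Σℚ-*ˡ xs (ι (suc h ℕ.≡ᵇ i)) (f (suc h))) (Σℚ-*ˡ xs (ι (h ℕ.≡ᵇ i)) (f h)) ⟩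
        ι (suc h ℕ.≡ᵇ i) * Σℚ xs (f (suc h)) + ι (h ℕ.≡ᵇ i) * Σℚ xs (f h)
          ≡⟨ cong₂ (λ x y → ι (suc h ℕ.≡ᵇ i) * x + ι (h ℕ.≡ᵇ i) * y) (Σf (suc h)) (Σf h) ⟩
        ι (suc h ℕ.≡ᵇ i) * F (suc h) + ι (h ℕ.≡ᵇ i) * F h
          ≡⟨ cong₂ _+_ (δ-reflects (suc h) i F) (δ-reflects h i F) ⟩
        δ i (suc h) * F i + δ i h * F i
          ≡⟨ sym (ℚP.*-distribʳ-+ (F i) (δ i (suc h)) (δ i h)) ⟩
        (δ i (suc h) + δ (suc i) (suc h)) * F i ∎
      where open ≡-Reasoning

    pairSum-weightR : ∀ h w → pairSum (weightR h) w
                            ≡ T (λ h' → weightR h' w) h + atLevel (λ h' w' → γ * weight (suc h') w') h w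
    pairSum-weightR zero w = begin
        pairSum (weightR 0) w
          ≡⟨ pairSum-alternating-0 (λ x → γ ^ rises x * fromℕ (Rgo i 0 x)) w ⟩
        ι (altCheck 1 1 w) * ((γ * p) * fromℕ (Rgo i 0 (rise ∷ w))) + ι (altCheck 1 0 w) * (p * R₀)
          ≡⟨ cong (λ z → ι (altCheck 1 1 w) * ((γ * p) * z) + ι (altCheck 1 0 w) * (p * R₀)) (Rgo-rise i 0 w) ⟩
        ι (altCheck 1 1 w) * ((γ * p) * (ι (0 ℕ.≡ᵇ i) + R₁)) + ι (altCheck 1 0 w) * (p * R₀)
          ≡⟨ regroup γ p (ι (altCheck 1 1 w)) (ι (altCheck 1 0 w)) (ι (0 ℕ.≡ᵇ i)) R₀ R₁ ⟩
        T (λ h' → weightR h' w) 0 + atLevel (λ h' w' → γ * weight (suc h') w') 0 w ∎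
      where
      open ≡-Reasoning
      p  = γ ^ rises w
      R₀ = fromℕ (Rgo i 0 w)
      R₁ = fromℕ (Rgo i 1 w)
      regroup : ∀ g p x y m R₀ R₁ → x * ((g * p) * (m + R₁)) + y * (p * R₀)
                                  ≡ (y * (p * R₀) + g * (x * (p * R₁))) + m * (g * (x * p))
      regroup = ℚ-solve ℚ-ring
    pairSum-weightR (suc h) w = begin
        pairSum (weightR (suc h)) w
          ≡⟨ pairSum-alternating-suc h (λ x → γ ^ rises x * fromℕ (Rgo i (suc h) x)) w ⟩
        a₂ * ((γ * p) * fromℕ (Rgo i (suc h) (rise ∷ w))) + a₁ * ((γ * p) * fromℕ (Rgo i h (rise ∷ w)))
          + a₀ * (p * R₀) + a₁ * (p * R₁)
          ≡⟨ cong₂ (λ x y → a₂ * ((γ * p) * x) + a₁ * ((γ * p) * y) + a₀ * (p * R₀) + a₁ * (p * R₁))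
                   (Rgo-rise i (suc h) w) (Rgo-rise i h w) ⟩
        a₂ * ((γ * p) * (ι (suc h ℕ.≡ᵇ i) + R₂)) + a₁ * ((γ * p) * (ι (h ℕ.≡ᵇ i) + R₁))
          + a₀ * (p * R₀) + a₁ * (p * R₁)
          ≡⟨ regroup γ p a₀ a₁ a₂ (ι (h ℕ.≡ᵇ i)) (ι (suc h ℕ.≡ᵇ i)) R₀ R₁ R₂ ⟩
        T (λ h' → weightR h' w) (suc h) + atLevel (λ h' w' → γ * weight (suc h') w') (suc h) w ∎
      where
      open ≡-Reasoning
      p  = γ ^ rises w
      a₀ = ι (altCheck 1 h w)
      a₁ = ι (altCheck 1 (suc h) w)
      a₂ = ι (altCheck 1 (suc (suc h)) w)
      R₀ = fromℕ (Rgo i h w)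
      R₁ = fromℕ (Rgo i (suc h) w)
      R₂ = fromℕ (Rgo i (suc (suc h)) w)
      regroup : ∀ g p a b c mh ms R₀ R₁ R₂ →
        c * ((g * p) * (ms + R₂)) + b * ((g * p) * (mh + R₁)) + a * (p * R₀) + b * (p * R₁)
        ≡ (a * (p * R₀) + (1ℚ + g) * (b * (p * R₁)) + g * (c * (p * R₂))) + (ms * (g * (c * p)) + mh * (g * (b * p)))
      regroup = ℚ-solve ℚ-ring

    pairSum-weightL : ∀ h w → pairSum (weightL h) w ≡ T (λ h' → weightL h' w) h + atLevel weight h w
    pairSum-weightL zero w = begin
        pairSum (weightL 0) w
          ≡⟨ pairSum-alternating-0 (λ x → γ ^ rises x * fromℕ (Lgo i 1 0 x)) w ⟩
        ι (altCheck 1 1 w) * ((γ * p) * fromℕ (Lgo i 3 1 w)) + ι (altCheck 1 0 w) * (p * fromℕ (Lgo i 2 0 (level ∷ w)))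
          ≡⟨ cong₂ (λ x y → ι (altCheck 1 1 w) * ((γ * p) * fromℕ x) + ι (altCheck 1 0 w) * (p * y))
                   (Lgo-+2 i 1 1 w) (Lgo-2-level i 0 w) ⟩
        ι (altCheck 1 1 w) * ((γ * p) * L₁) + ι (altCheck 1 0 w) * (p * (ι (0 ℕ.≡ᵇ i) + L₀))
          ≡⟨ regroup γ p (ι (altCheck 1 1 w)) (ι (altCheck 1 0 w)) (ι (0 ℕ.≡ᵇ i)) L₀ L₁ ⟩
        T (λ h' → weightL h' w) 0 + atLevel weight 0 w ∎
      where
      open ≡-Reasoning
      p  = γ ^ rises w
      L₀ = fromℕ (Lgo i 1 0 w)
      L₁ = fromℕ (Lgo i 1 1 w)
      regroup : ∀ g p x y m L₀ L₁ → x * ((g * p) * L₁) + y * (p * (m + L₀))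
                                  ≡ (y * (p * L₀) + g * (x * (p * L₁))) + m * (y * p)
      regroup = ℚ-solve ℚ-ring
    pairSum-weightL (suc h) w = begin
        pairSum (weightL (suc h)) w
          ≡⟨ pairSum-alternating-suc h (λ x → γ ^ rises x * fromℕ (Lgo i 1 (suc h) x)) w ⟩
        a₂ * ((γ * p) * fromℕ (Lgo i 3 (suc (suc h)) w)) + a₁ * ((γ * p) * fromℕ (Lgo i 3 (suc h) w))
          + a₀ * (p * fromℕ (Lgo i 2 h (level ∷ w))) + a₁ * (p * fromℕ (Lgo i 2 (suc h) (level ∷ w)))
          ≡⟨ cong₂ _+_ (cong₂ _+_ (cong₂ (λ x y → a₂ * ((γ * p) * fromℕ x) + a₁ * ((γ * p) * fromℕ y))
                                         (Lgo-+2 i 1 (suc (suc h)) w) (Lgo-+2 i 1 (suc h) w))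
                                  (cong (λ z → a₀ * (p * z)) (Lgo-2-level i h w)))
                       (cong (λ z → a₁ * (p * z)) (Lgo-2-level i (suc h) w)) ⟩
        a₂ * ((γ * p) * L₂) + a₁ * ((γ * p) * L₁) + a₀ * (p * (ι (h ℕ.≡ᵇ i) + L₀)) + a₁ * (p * (ι (suc h ℕ.≡ᵇ i) + L₁))
          ≡⟨ regroup γ p a₀ a₁ a₂ (ι (h ℕ.≡ᵇ i)) (ι (suc h ℕ.≡ᵇ i)) L₀ L₁ L₂ ⟩
        T (λ h' → weightL h' w) (suc h) + atLevel weight (suc h) w ∎
      where
      open ≡-Reasoning
      p  = γ ^ rises w
      a₀ = ι (altCheck 1 h w)
      a₁ = ι (altCheck 1 (suc h) w)
      a₂ = ι (altCheck 1 (suc (suc h)) w)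
      L₀ = fromℕ (Lgo i 1 h w)
      L₁ = fromℕ (Lgo i 1 (suc h) w)
      L₂ = fromℕ (Lgo i 1 (suc (suc h)) w)
      regroup : ∀ g p a b c mh ms L₀ L₁ L₂ →
        c * ((g * p) * L₂) + b * ((g * p) * L₁) + a * (p * (mh + L₀)) + b * (p * (ms + L₁))
        ≡ (a * (p * L₀) + (1ℚ + g) * (b * (p * L₁)) + g * (c * (p * L₂))) + (ms * (b * p) + mh * (a * p))
      regroup = ℚ-solve ℚ-ring

    ΣweightR≡pathSum : ∀ n → Σℚ (words (double (suc n))) (weightR 0) ≡ γ ^ suc i * pathSum (suc n) (suc (i ℕ.+ suc i))
    ΣweightR≡pathSum n = begin
        P (suc n) 0
          ≡⟨ duhamel i B P P₀ P-step n 0 ⟩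
        conv (λ a → kernel-pair i B a 0) B n
          ≡⟨ conv-kernel-pair-at-0 i B n ⟩
        γ ^ i * conv (λ a → pathSum⁺ a i) B n
          ≡⟨ cong (γ ^ i *_) (conv-*ʳ γ (λ a → pathSum⁺ a i) (λ b → pathSum b (suc i)) n) ⟩
        γ ^ i * (γ * conv (λ a → pathSum⁺ a i) (λ b → pathSum b (suc i)) n)
          ≡⟨ cong (λ z → γ ^ i * (γ * z)) (sym (pathSum-conv n i (suc i))) ⟩
        γ ^ i * (γ * pathSum (suc n) (suc (i ℕ.+ suc i)))
          ≡⟨ reassoc γ (γ ^ i) (pathSum (suc n) (suc (i ℕ.+ suc i))) ⟩
        γ ^ suc i * pathSum (suc n) (suc (i ℕ.+ suc i)) ∎
      where
      open ≡-Reasoning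
      P : ℕ → ℕ → ℚ
      P m h = Σℚ (words (double m)) (weightR h)
      B : ℕ → ℚ
      B m = γ * pathSum m (suc i)
      P₀ : ∀ h → P 0 h ≡ 0ℚ
      P₀ zero    = refl
      P₀ (suc h) = refl
      P-step : ∀ m h → P (suc m) h ≡ T (P m) h + source i B m h
      P-step m h = trans (Σℚ-words-T (double m) h (weightR h) weightR _ (pairSum-weightR h))
        (cong (T (P m) h +_) (Σℚ-atLevel (words (double m)) (λ h' w → γ * weight (suc h') w) (λ h' → γ * pathSum m (suc h'))
          (λ h' → trans (Σℚ-*ˡ (words (double m)) γ (weight (suc h'))) (cong (γ *_) (Σweight≡pathSum m (suc h')))) h))
      reassoc : ∀ g q x → q * (g * x) ≡ (g * q) * x
      reassoc = ℚ-solve ℚ-ring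

    ΣweightL≡pathSum : ∀ n → Σℚ (words (double (suc n))) (weightL 0) ≡ γ ^ i * pathSum (suc n) (suc (i ℕ.+ i))
    ΣweightL≡pathSum n = begin
        P (suc n) 0
          ≡⟨ duhamel i B P P₀ P-step n 0 ⟩
        conv (λ a → kernel-pair i B a 0) B n
          ≡⟨ conv-kernel-pair-at-0 i B n ⟩
        γ ^ i * conv (λ a → pathSum⁺ a i) B n
          ≡⟨ cong (γ ^ i *_) (sym (pathSum-conv n i i)) ⟩
        γ ^ i * pathSum (suc n) (suc (i ℕ.+ i)) ∎
      where
      open ≡-Reasoning
      P : ℕ → ℕ → ℚ
      P m h = Σℚ (words (double m)) (weightL h)
      B : ℕ → ℚ
      B m = pathSum m i
      P₀ : ∀ h → P 0 h ≡ 0ℚ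
      P₀ zero    = refl
      P₀ (suc h) = refl
      P-step : ∀ m h → P (suc m) h ≡ T (P m) h + source i B m h
      P-step m h = trans (Σℚ-words-T (double m) h (weightL h) weightL _ (pairSum-weightL h))
        (cong (T (P m) h +_) (Σℚ-atLevel (words (double m)) weight (pathSum m) (Σweight≡pathSum m) h))

binom : ℕ → ℕ → ℕ
binom n       zero    = 1
binom zero    (suc k) = 0
binom (suc n) (suc k) = binom n k ℕ.+ binom n (suc k)

-- pathCount n h r is the coefficient of γ ^ r in pathSum n h (see pathSum≡poly).
pathCount : ℕ → ℕ → ℕ → ℕ
pathCount zero    zero    zero    = 1
pathCount zero    zero    (suc r) = 0
pathCount zero    (suc h) r       = 0
pathCount (suc n) zero    zero    = pathCount n 0 0
pathCount (suc n) zero    (suc r) = pathCount n 0 (suc r) ℕ.+ pathCount n 1 r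
pathCount (suc n) (suc h) zero    = pathCount n h 0 ℕ.+ pathCount n (suc h) 0
pathCount (suc n) (suc h) (suc r) = pathCount n h (suc r) ℕ.+ pathCount n (suc h) (suc r)
                                    ℕ.+ (pathCount n (suc h) r ℕ.+ pathCount n (suc (suc h)) r)

reflected : ℕ → ℕ → ℕ → ℕ
reflected N zero    t = 0
reflected N (suc r) t = binom N r ℕ.* binom (suc N) (suc t)

-- The reflection principle: pathCount (1 + N) h r = C(N, r) C(1 + N, h + r) − C(N, r − 1) C(1 + N, h + r + 1),
-- stated additively so that no truncated subtraction occurs. The induction adds the correction
-- terms of all recursive calls to both sides and cancels them.
pathCount-reflection : ∀ N h r → pathCount (suc N) h r ℕ.+ reflected N r (h ℕ.+ r) ≡ binom N r ℕ.* binom (suc N) (h ℕ.+ r)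

pathCount-reflection-at : ∀ N h r t → h ℕ.+ r ≡ t → pathCount (suc N) h r ℕ.+ reflected N r t ≡ binom N r ℕ.* binom (suc N) t
pathCount-reflection-at N h r t refl = pathCount-reflection N h r

pathCount-reflection zero zero          zero          = refl
pathCount-reflection zero (suc zero)    zero          = refl
pathCount-reflection zero (suc (suc h)) zero          = refl
pathCount-reflection zero zero          (suc zero)    = refl
pathCount-reflection zero zero          (suc (suc r)) = refl
pathCount-reflection zero (suc zero)    (suc zero)    = refl
pathCount-reflection zero (suc (suc h)) (suc zero)    = refl
pathCount-reflection zero (suc zero)    (suc (suc r)) = refl
pathCount-reflection zero (suc (suc h)) (suc (suc r)) = refl
pathCount-reflection (suc N) zero zero = pathCount-reflection N 0 0
pathCount-reflection (suc N) zero (suc r) = ℕP.+-cancelʳ-≡ (d (suc r) ℕ.+ d r) _ _ (begin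
    (c 0 (suc r) ℕ.+ c 1 r ℕ.+ reflected (suc N) (suc r) t) ℕ.+ (d (suc r) ℕ.+ d r)
      ≡⟨ regroup (c 0 (suc r)) (c 1 r) (d (suc r)) (d r) (reflected (suc N) (suc r) t) ⟩
    (c 0 (suc r) ℕ.+ d (suc r)) ℕ.+ (c 1 r ℕ.+ d r) ℕ.+ reflected (suc N) (suc r) t
      ≡⟨ cong (ℕ._+ reflected (suc N) (suc r) t) (cong₂ ℕ._+_ (pathCount-reflection N 0 (suc r)) (pathCount-reflection N 1 r)) ⟩
    binom N (suc r) ℕ.* binom (suc N) t ℕ.+ binom N r ℕ.* binom (suc N) t ℕ.+ reflected (suc N) (suc r) t
      ≡⟨ pascal r ⟩
    binom (suc N) (suc r) ℕ.* binom (suc (suc N)) t ℕ.+ (d (suc r) ℕ.+ d r) ∎)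
  where
  open ≡-Reasoning
  t = suc r
  c = pathCount (suc N)
  d : ℕ → ℕ
  d r' = reflected N r' t
  regroup : ∀ c₁ c₂ d₁ d₂ e → (c₁ ℕ.+ c₂ ℕ.+ e) ℕ.+ (d₁ ℕ.+ d₂) ≡ (c₁ ℕ.+ d₁) ℕ.+ (c₂ ℕ.+ d₂) ℕ.+ e
  regroup = ℕ-Solver.solve-∀
  pascal : ∀ r → binom N (suc r) ℕ.* binom (suc N) (suc r) ℕ.+ binom N r ℕ.* binom (suc N) (suc r) ℕ.+ reflected (suc N) (suc r) (suc r)
                 ≡ binom (suc N) (suc r) ℕ.* binom (suc (suc N)) (suc r) ℕ.+ (reflected N (suc r) (suc r) ℕ.+ reflected N r (suc r))
  pascal zero = identity (binom N 1) (binom N 2)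
    where
    identity : ∀ x₁ x₂ → x₁ ℕ.* (1 ℕ.+ x₁) ℕ.+ 1 ℕ.* (1 ℕ.+ x₁) ℕ.+ 1 ℕ.* ((1 ℕ.+ x₁) ℕ.+ (x₁ ℕ.+ x₂))
                       ≡ (1 ℕ.+ x₁) ℕ.* (1 ℕ.+ (1 ℕ.+ x₁)) ℕ.+ (1 ℕ.* (x₁ ℕ.+ x₂) ℕ.+ 0)
    identity = ℕ-Solver.solve-∀
  pascal (suc r) = identity (binom N r) (binom N (suc r)) (binom N (suc (suc r))) (binom N (suc (suc (suc r))))
    where
    identity : ∀ x₀ x₁ x₂ x₃ → x₂ ℕ.* (x₁ ℕ.+ x₂) ℕ.+ x₁ ℕ.* (x₁ ℕ.+ x₂) ℕ.+ (x₀ ℕ.+ x₁) ℕ.* ((x₁ ℕ.+ x₂) ℕ.+ (x₂ ℕ.+ x₃))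
                             ≡ (x₁ ℕ.+ x₂) ℕ.* ((x₀ ℕ.+ x₁) ℕ.+ (x₁ ℕ.+ x₂)) ℕ.+ (x₁ ℕ.* (x₂ ℕ.+ x₃) ℕ.+ x₀ ℕ.* (x₂ ℕ.+ x₃))
    identity = ℕ-Solver.solve-∀
pathCount-reflection (suc N) (suc h) zero = begin
    c h 0 ℕ.+ c (suc h) 0 ℕ.+ 0
      ≡⟨ pad (c h 0) (c (suc h) 0) ⟩
    (c h 0 ℕ.+ 0) ℕ.+ (c (suc h) 0 ℕ.+ 0)
      ≡⟨ cong₂ ℕ._+_ (pathCount-reflection N h 0) (pathCount-reflection N (suc h) 0) ⟩
    1 ℕ.* binom (suc N) (h ℕ.+ 0) ℕ.+ 1 ℕ.* binom (suc N) (suc (h ℕ.+ 0))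
      ≡⟨ sym (ℕP.*-distribˡ-+ 1 (binom (suc N) (h ℕ.+ 0)) _) ⟩
    1 ℕ.* binom (suc (suc N)) (suc h ℕ.+ 0) ∎
  where
  open ≡-Reasoning
  c = pathCount (suc N)
  pad : ∀ a b → a ℕ.+ b ℕ.+ 0 ≡ (a ℕ.+ 0) ℕ.+ (b ℕ.+ 0)
  pad = ℕ-Solver.solve-∀
pathCount-reflection (suc N) (suc h) (suc r) = ℕP.+-cancelʳ-≡ D _ _ (begin
    (c h (suc r) ℕ.+ c (suc h) (suc r) ℕ.+ (c (suc h) r ℕ.+ c (suc (suc h)) r) ℕ.+ reflected (suc N) (suc r) (suc t)) ℕ.+ D
      ≡⟨ regroup (c h (suc r)) (c (suc h) (suc r)) (c (suc h) r) (c (suc (suc h)) r)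
                 (d (suc r) t) (d (suc r) (suc t)) (d r t) (d r (suc t)) (reflected (suc N) (suc r) (suc t)) ⟩
    ((c h (suc r) ℕ.+ d (suc r) t) ℕ.+ (c (suc h) (suc r) ℕ.+ d (suc r) (suc t)))
      ℕ.+ ((c (suc h) r ℕ.+ d r t) ℕ.+ (c (suc (suc h)) r ℕ.+ d r (suc t))) ℕ.+ reflected (suc N) (suc r) (suc t)
      ≡⟨ cong (ℕ._+ reflected (suc N) (suc r) (suc t))
              (cong₂ ℕ._+_ (cong₂ ℕ._+_ (pathCount-reflection-at N h (suc r) t refl)
                                        (pathCount-reflection-at N (suc h) (suc r) (suc t) refl))
                           (cong₂ ℕ._+_ (pathCount-reflection-at N (suc h) r t h+1+r≡t)
                                        (pathCount-reflection-at N (suc (suc h)) r (suc t) (cong suc h+1+r≡t)))) ⟩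
    (binom N (suc r) ℕ.* B t ℕ.+ binom N (suc r) ℕ.* B (suc t)) ℕ.+ (binom N r ℕ.* B t ℕ.+ binom N r ℕ.* B (suc t))
      ℕ.+ reflected (suc N) (suc r) (suc t)
      ≡⟨ pascal r ⟩
    binom (suc N) (suc r) ℕ.* binom (suc (suc N)) (suc t) ℕ.+ D ∎)
  where
  open ≡-Reasoning
  t = h ℕ.+ suc r
  c = pathCount (suc N)
  d = reflected N
  B = binom (suc N)
  D = d (suc r) t ℕ.+ d (suc r) (suc t) ℕ.+ (d r t ℕ.+ d r (suc t))
  h+1+r≡t : suc (h ℕ.+ r) ≡ t
  h+1+r≡t = sym (ℕP.+-suc h r)
  regroup : ∀ c₁ c₂ c₃ c₄ d₁ d₂ d₃ d₄ e → (c₁ ℕ.+ c₂ ℕ.+ (c₃ ℕ.+ c₄) ℕ.+ e) ℕ.+ (d₁ ℕ.+ d₂ ℕ.+ (d₃ ℕ.+ d₄))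
                                        ≡ ((c₁ ℕ.+ d₁) ℕ.+ (c₂ ℕ.+ d₂)) ℕ.+ ((c₃ ℕ.+ d₃) ℕ.+ (c₄ ℕ.+ d₄)) ℕ.+ e
  regroup = ℕ-Solver.solve-∀
  pascal : ∀ r → (binom N (suc r) ℕ.* B (h ℕ.+ suc r) ℕ.+ binom N (suc r) ℕ.* B (suc (h ℕ.+ suc r)))
                 ℕ.+ (binom N r ℕ.* B (h ℕ.+ suc r) ℕ.+ binom N r ℕ.* B (suc (h ℕ.+ suc r)))
                 ℕ.+ reflected (suc N) (suc r) (suc (h ℕ.+ suc r))
               ≡ binom (suc N) (suc r) ℕ.* binom (suc (suc N)) (suc (h ℕ.+ suc r))
                 ℕ.+ (d (suc r) (h ℕ.+ suc r) ℕ.+ d (suc r) (suc (h ℕ.+ suc r)) ℕ.+ (d r (h ℕ.+ suc r) ℕ.+ d r (suc (h ℕ.+ suc r))))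
  pascal zero = identity (binom N 1) (B (h ℕ.+ 1)) (B (suc (h ℕ.+ 1))) (B (suc (suc (h ℕ.+ 1))))
    where
    identity : ∀ x₁ b₀ b₁ b₂ → x₁ ℕ.* b₀ ℕ.+ x₁ ℕ.* b₁ ℕ.+ (1 ℕ.* b₀ ℕ.+ 1 ℕ.* b₁) ℕ.+ 1 ℕ.* (b₁ ℕ.+ b₂)
                             ≡ (1 ℕ.+ x₁) ℕ.* (b₀ ℕ.+ b₁) ℕ.+ ((1 ℕ.* b₁ ℕ.+ 1 ℕ.* b₂) ℕ.+ (0 ℕ.+ 0))
    identity = ℕ-Solver.solve-∀
  pascal (suc r) = identity (binom N r) (binom N (suc r)) (binom N (suc (suc r)))
                            (B (h ℕ.+ suc (suc r))) (B (suc (h ℕ.+ suc (suc r)))) (B (suc (suc (h ℕ.+ suc (suc r)))))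
    where
    identity : ∀ x₀ x₁ x₂ b₀ b₁ b₂ → x₂ ℕ.* b₀ ℕ.+ x₂ ℕ.* b₁ ℕ.+ (x₁ ℕ.* b₀ ℕ.+ x₁ ℕ.* b₁) ℕ.+ (x₀ ℕ.+ x₁) ℕ.* (b₁ ℕ.+ b₂)
                                   ≡ (x₁ ℕ.+ x₂) ℕ.* (b₀ ℕ.+ b₁) ℕ.+ ((x₁ ℕ.* b₁ ℕ.+ x₁ ℕ.* b₂) ℕ.+ (x₀ ℕ.* b₁ ℕ.+ x₀ ℕ.* b₂))
    identity = ℕ-Solver.solve-∀

pathCount-vanishes : ∀ n h r → n ℕ.< r → pathCount n h r ≡ 0
pathCount-vanishes zero    zero    (suc r) _         = refl
pathCount-vanishes zero    (suc h) r       _         = refl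
pathCount-vanishes (suc n) zero    (suc r) (s≤s n<r) =
  cong₂ ℕ._+_ (pathCount-vanishes n 0 (suc r) (ℕP.m<n⇒m<1+n n<r)) (pathCount-vanishes n 1 r n<r)
pathCount-vanishes (suc n) (suc h) (suc r) (s≤s n<r) =
  cong₂ ℕ._+_ (cong₂ ℕ._+_ (pathCount-vanishes n h (suc r) (ℕP.m<n⇒m<1+n n<r))
                           (pathCount-vanishes n (suc h) (suc r) (ℕP.m<n⇒m<1+n n<r)))
              (cong₂ ℕ._+_ (pathCount-vanishes n (suc h) r n<r) (pathCount-vanishes n (suc (suc h)) r n<r))

binom-absorption : ∀ n k → suc k ℕ.* binom (suc n) (suc k) ≡ suc n ℕ.* binom n k
binom-absorption zero    zero    = refl
binom-absorption zero    (suc k) = ℕP.*-zeroʳ (suc (suc k))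
binom-absorption (suc n) zero    =
  trans (expand (binom (suc n) 1)) (trans (cong (1 ℕ.+_) (binom-absorption n 0)) (collect n))
  where
  expand : ∀ y → 1 ℕ.* (1 ℕ.+ y) ≡ 1 ℕ.+ 1 ℕ.* y
  expand = ℕ-Solver.solve-∀
  collect : ∀ n → 1 ℕ.+ suc n ℕ.* 1 ≡ suc (suc n) ℕ.* 1
  collect = ℕ-Solver.solve-∀
binom-absorption (suc n) (suc k) = begin
    suc (suc k) ℕ.* (binom (suc n) (suc k) ℕ.+ binom (suc n) (suc (suc k)))
      ≡⟨ split k (binom (suc n) (suc k)) (binom (suc n) (suc (suc k))) ⟩
    suc k ℕ.* binom (suc n) (suc k) ℕ.+ binom (suc n) (suc k) ℕ.+ suc (suc k) ℕ.* binom (suc n) (suc (suc k))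
      ≡⟨ cong₂ (λ x y → x ℕ.+ binom (suc n) (suc k) ℕ.+ y) (binom-absorption n k) (binom-absorption n (suc k)) ⟩
    suc n ℕ.* binom n k ℕ.+ (binom n k ℕ.+ binom n (suc k)) ℕ.+ suc n ℕ.* binom n (suc k)
      ≡⟨ collect n (binom n k) (binom n (suc k)) ⟩
    suc (suc n) ℕ.* (binom n k ℕ.+ binom n (suc k)) ∎
  where
  open ≡-Reasoning
  split : ∀ k x y → suc (suc k) ℕ.* (x ℕ.+ y) ≡ suc k ℕ.* x ℕ.+ x ℕ.+ suc (suc k) ℕ.* y
  split = ℕ-Solver.solve-∀
  collect : ∀ n x y → suc n ℕ.* x ℕ.+ (x ℕ.+ y) ℕ.+ suc n ℕ.* y ≡ suc (suc n) ℕ.* (x ℕ.+ y)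
  collect = ℕ-Solver.solve-∀

binom-absorption′ : ∀ n k → suc k ℕ.* binom n (suc k) ℕ.+ suc k ℕ.* binom n k ≡ suc n ℕ.* binom n k
binom-absorption′ n k =
  trans (ℕP.+-comm (suc k ℕ.* binom n (suc k)) _)
        (trans (sym (ℕP.*-distribˡ-+ (suc k) (binom n k) (binom n (suc k)))) (binom-absorption n k))

binom≡C : ∀ n k → binom n k ≡ n C k
binom≡C n       zero    = refl
binom≡C zero    (suc k) = refl
binom≡C (suc n) (suc k) = trans (cong₂ ℕ._+_ (binom≡C n k) (binom≡C n (suc k))) (nCk+nC[k+1]≡[n+1]C[k+1] n k)

narayana-count : ∀ N r → suc r ℕ.* pathCount (suc N) 0 r ≡ binom (suc N) r ℕ.* binom N r
narayana-count N zero    = trans (ℕP.*-identityˡ _) (trans (sym (ℕP.+-identityʳ _)) (pathCount-reflection N 0 0))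
narayana-count N (suc r) = ℕP.+-cancelʳ-≡ (suc (suc r) ℕ.* (x0 ℕ.* binom (suc N) (suc (suc r)))) _ _ (begin
    suc (suc r) ℕ.* c ℕ.+ suc (suc r) ℕ.* (x0 ℕ.* binom (suc N) (suc (suc r)))
      ≡⟨ sym (ℕP.*-distribˡ-+ (suc (suc r)) c _) ⟩
    suc (suc r) ℕ.* (c ℕ.+ x0 ℕ.* binom (suc N) (suc (suc r)))
      ≡⟨ cong (suc (suc r) ℕ.*_) (pathCount-reflection N 0 (suc r)) ⟩
    suc (suc r) ℕ.* (x1 ℕ.* (x0 ℕ.+ x1))
      ≡⟨ expand r x0 x1 ⟩
    (x0 ℕ.+ x1) ℕ.* x1 ℕ.+ x1 ℕ.* (suc r ℕ.* x1 ℕ.+ suc r ℕ.* x0)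
      ≡⟨ cong (λ z → (x0 ℕ.+ x1) ℕ.* x1 ℕ.+ x1 ℕ.* z) (binom-absorption′ N r) ⟩
    (x0 ℕ.+ x1) ℕ.* x1 ℕ.+ x1 ℕ.* (suc N ℕ.* x0)
      ≡⟨ cong (λ z → (x0 ℕ.+ x1) ℕ.* x1 ℕ.+ z) (rotate x1 (suc N) x0) ⟩
    (x0 ℕ.+ x1) ℕ.* x1 ℕ.+ x0 ℕ.* (suc N ℕ.* x1)
      ≡⟨ cong (λ z → (x0 ℕ.+ x1) ℕ.* x1 ℕ.+ x0 ℕ.* z) (sym (binom-absorption N (suc r))) ⟩
    (x0 ℕ.+ x1) ℕ.* x1 ℕ.+ x0 ℕ.* (suc (suc r) ℕ.* binom (suc N) (suc (suc r)))
      ≡⟨ cong (ℕ._+_ ((x0 ℕ.+ x1) ℕ.* x1)) (swap x0 (suc (suc r)) (binom (suc N) (suc (suc r)))) ⟩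
    (x0 ℕ.+ x1) ℕ.* x1 ℕ.+ suc (suc r) ℕ.* (x0 ℕ.* binom (suc N) (suc (suc r))) ∎)
  where
  open ≡-Reasoning
  c = pathCount (suc N) 0 (suc r)
  x0 = binom N r
  x1 = binom N (suc r)
  expand : ∀ r x0 x1 → suc (suc r) ℕ.* (x1 ℕ.* (x0 ℕ.+ x1)) ≡ (x0 ℕ.+ x1) ℕ.* x1 ℕ.+ x1 ℕ.* (suc r ℕ.* x1 ℕ.+ suc r ℕ.* x0)
  expand = ℕ-Solver.solve-∀
  rotate : ∀ a b c → a ℕ.* (b ℕ.* c) ≡ c ℕ.* (b ℕ.* a)
  rotate = ℕ-Solver.solve-∀
  swap : ∀ a b c → a ℕ.* (b ℕ.* c) ≡ b ℕ.* (a ℕ.* c)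
  swap = ℕ-Solver.solve-∀

binom-vanishes : ∀ n k → n ℕ.< k → binom n k ≡ 0
binom-vanishes zero    (suc k) _         = refl
binom-vanishes (suc n) (suc k) (s≤s n<k) = cong₂ ℕ._+_ (binom-vanishes n k n<k) (binom-vanishes n (suc k) (ℕP.m<n⇒m<1+n n<k))

pathCount-top : ∀ N → pathCount (suc N) 0 (suc N) ≡ 0
pathCount-top N = ℕP.m+n≡0⇒m≡0 (pathCount (suc N) 0 (suc N))
  (trans (pathCount-reflection N 0 (suc N)) (cong (ℕ._* binom (suc N) (suc N)) (binom-vanishes N (suc N) ℕP.≤-refl)))

shift : (ℕ → ℕ) → ℕ → ℕ
shift e zero    = 0
shift e (suc r) = e r

pathCount-suc-zero : ∀ n r → pathCount (suc n) 0 r ≡ pathCount n 0 r ℕ.+ shift (pathCount n 1) r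
pathCount-suc-zero n zero    = sym (ℕP.+-identityʳ _)
pathCount-suc-zero n (suc r) = refl

pathCount-suc-suc : ∀ n h r → pathCount (suc n) (suc h) r
                              ≡ (pathCount n h r ℕ.+ pathCount n (suc h) r)
                                ℕ.+ shift (λ x → pathCount n (suc h) x ℕ.+ pathCount n (suc (suc h)) x) r
pathCount-suc-suc n h zero    = sym (ℕP.+-identityʳ _)
pathCount-suc-suc n h (suc r) = refl

module Coefficients (γ : ℚ) where
  open Transfer γ

  poly : (ℕ → ℕ) → ℕ → ℚ
  poly e M = Σ< (suc M) (λ r → γ ^ r * fromℕ (e r))

  poly-+ : ∀ (e e' : ℕ → ℕ) M → poly (λ r → e r ℕ.+ e' r) M ≡ poly e M + poly e' M
  poly-+ e e' M =
    trans (Σ<-cong (suc M) (λ r → trans (cong (γ ^ r *_) (fromℕ-+ (e r) (e' r))) (ℚP.*-distribˡ-+ (γ ^ r) (fromℕ (e r)) (fromℕ (e' r)))))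
          (Σℚ-+ (upTo (suc M)) (λ r → γ ^ r * fromℕ (e r)) (λ r → γ ^ r * fromℕ (e' r)))

  poly-cong : ∀ {e e' : ℕ → ℕ} M → (∀ r → e r ≡ e' r) → poly e M ≡ poly e' M
  poly-cong M eq = Σ<-cong (suc M) (λ r → cong (λ z → γ ^ r * fromℕ z) (eq r))

  poly-+-γ* : ∀ (e e' : ℕ → ℕ) M → e' M ≡ 0 → poly e M + γ * poly e' M ≡ poly (λ r → e r ℕ.+ shift e' r) M
  poly-+-γ* e e' M e'M≡0 = begin
      poly e M + γ * poly e' M
        ≡⟨ cong (λ z → poly e M + γ * z) (Σ<-snoc M g) ⟩
      poly e M + γ * (Σ< M g + γ ^ M * fromℕ (e' M))
        ≡⟨ cong (λ z → poly e M + γ * (Σ< M g + γ ^ M * fromℕ z)) e'M≡0 ⟩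
      poly e M + γ * (Σ< M g + γ ^ M * 0ℚ)
        ≡⟨ cong (poly e M +_) (shiftSum γ (Σ< M g) (γ ^ M)) ⟩
      poly e M + (1ℚ * 0ℚ + γ * Σ< M g)
        ≡⟨ cong (λ z → poly e M + (1ℚ * 0ℚ + z)) (sym (trans (Σ<-cong M (λ r → ℚP.*-assoc γ (γ ^ r) (fromℕ (e' r))))
                                                             (Σℚ-*ˡ (upTo M) γ g))) ⟩
      poly e M + (1ℚ * 0ℚ + Σ< M (λ r → γ ^ suc r * fromℕ (e' r)))
        ≡⟨ cong (poly e M +_) (sym (Σ<-suc M (λ r → γ ^ r * fromℕ (shift e' r)))) ⟩
      poly e M + poly (shift e') M
        ≡⟨ sym (poly-+ e (shift e') M) ⟩
      poly (λ r → e r ℕ.+ shift e' r) M ∎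
    where
    open ≡-Reasoning
    g : ℕ → ℚ
    g r = γ ^ r * fromℕ (e' r)
    shiftSum : ∀ c S p → c * (S + p * 0ℚ) ≡ 1ℚ * 0ℚ + c * S
    shiftSum = ℚ-solve ℚ-ring

  pathSum≡poly : ∀ M n h → n ℕ.< M → pathSum n h ≡ poly (pathCount n h) M
  pathSum≡poly M zero zero _ = sym (begin
      poly (pathCount 0 0) M                  ≡⟨ Σ<-suc M (λ r → γ ^ r * fromℕ (pathCount 0 0 r)) ⟩
      1ℚ * 1ℚ + Σ< M (λ r → γ ^ suc r * 0ℚ)   ≡⟨ cong (1ℚ * 1ℚ +_) (trans (Σ<-cong M (λ r → ℚP.*-zeroʳ (γ ^ suc r))) (Σℚ-0 (upTo M))) ⟩
      1ℚ * 1ℚ + 0ℚ                            ≡⟨ ℚP.+-identityʳ _ ⟩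
      1ℚ                                      ∎)
    where open ≡-Reasoning
  pathSum≡poly M zero (suc h) _ = sym (trans (Σ<-cong (suc M) (λ r → ℚP.*-zeroʳ (γ ^ r))) (Σℚ-0 (upTo (suc M))))
  pathSum≡poly M (suc n) zero n+1<M = begin
      pathSum n 0 + γ * pathSum n 1
        ≡⟨ cong₂ (λ x y → x + γ * y) (pathSum≡poly M n 0 n<M) (pathSum≡poly M n 1 n<M) ⟩
      poly (c 0) M + γ * poly (c 1) M
        ≡⟨ poly-+-γ* (c 0) (c 1) M (pathCount-vanishes n 1 M n<M) ⟩
      poly (λ r → c 0 r ℕ.+ shift (c 1) r) M
        ≡⟨ poly-cong M (λ r → sym (pathCount-suc-zero n r)) ⟩
      poly (pathCount (suc n) 0) M ∎
    where
    open ≡-Reasoning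
    c = pathCount n
    n<M = ℕP.<-trans (ℕP.n<1+n n) n+1<M
  pathSum≡poly M (suc n) (suc h) n+1<M = begin
      pathSum n h + (1ℚ + γ) * pathSum n (suc h) + γ * pathSum n (suc (suc h))
        ≡⟨ cong₂ _+_ (cong₂ (λ x y → x + (1ℚ + γ) * y) (pathSum≡poly M n h n<M) (pathSum≡poly M n (suc h) n<M))
                     (cong (γ *_) (pathSum≡poly M n (suc (suc h)) n<M)) ⟩
      poly (c h) M + (1ℚ + γ) * poly (c (suc h)) M + γ * poly (c (suc (suc h))) M
        ≡⟨ regroup γ (poly (c h) M) (poly (c (suc h)) M) (poly (c (suc (suc h))) M) ⟩
      (poly (c h) M + poly (c (suc h)) M) + γ * (poly (c (suc h)) M + poly (c (suc (suc h))) M)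
        ≡⟨ cong₂ (λ x y → x + γ * y) (sym (poly-+ (c h) (c (suc h)) M)) (sym (poly-+ (c (suc h)) (c (suc (suc h))) M)) ⟩
      poly (λ r → c h r ℕ.+ c (suc h) r) M + γ * poly (λ r → c (suc h) r ℕ.+ c (suc (suc h)) r) M
        ≡⟨ poly-+-γ* (λ r → c h r ℕ.+ c (suc h) r) (λ r → c (suc h) r ℕ.+ c (suc (suc h)) r) M
                     (cong₂ ℕ._+_ (pathCount-vanishes n (suc h) M n<M) (pathCount-vanishes n (suc (suc h)) M n<M)) ⟩
      poly (λ r → (c h r ℕ.+ c (suc h) r) ℕ.+ shift (λ x → c (suc h) x ℕ.+ c (suc (suc h)) x) r) M
        ≡⟨ poly-cong M (λ r → sym (pathCount-suc-suc n h r)) ⟩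
      poly (pathCount (suc n) (suc h)) M ∎
    where
    open ≡-Reasoning
    c = pathCount n
    n<M = ℕP.<-trans (ℕP.n<1+n n) n+1<M
    regroup : ∀ g a b c → a + (1ℚ + g) * b + g * c ≡ (a + b) + g * (b + c)
    regroup = ℚ-solve ℚ-ring

  pathSum≡Narayana : ∀ N → pathSum (suc N) 0 ≡ Narayana (suc N) γ
  pathSum≡Narayana N = begin
      pathSum (suc N) 0
        ≡⟨ pathSum≡poly (suc (suc N)) (suc N) 0 ℕP.≤-refl ⟩
      Σ< (suc (suc (suc N))) f
        ≡⟨ Σ<-snoc (suc (suc N)) f ⟩
      Σ< (suc (suc N)) f + f (suc (suc N))
        ≡⟨ cong₂ _+_ (Σ<-snoc (suc N) f) (cong (λ z → γ ^ suc (suc N) * fromℕ z) (pathCount-vanishes (suc N) 0 (suc (suc N)) ℕP.≤-refl)) ⟩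
      (Σ< (suc N) f + f (suc N)) + γ ^ suc (suc N) * 0ℚ
        ≡⟨ cong (λ z → (Σ< (suc N) f + γ ^ suc N * fromℕ z) + γ ^ suc (suc N) * 0ℚ) (pathCount-top N) ⟩
      (Σ< (suc N) f + γ ^ suc N * 0ℚ) + γ ^ suc (suc N) * 0ℚ
        ≡⟨ drop-zeros (Σ< (suc N) f) (γ ^ suc N) (γ ^ suc (suc N)) ⟩
      Σ< (suc N) f
        ≡⟨ Σ<-cong (suc N) (λ r → cong (γ ^ r *_) (coefficient r)) ⟩
      Narayana (suc N) γ ∎
    where
    open ≡-Reasoning
    f : ℕ → ℚ
    f r = γ ^ r * fromℕ (pathCount (suc N) 0 r)
    drop-zeros : ∀ S p q → (S + p * 0ℚ) + q * 0ℚ ≡ S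
    drop-zeros = ℚ-solve ℚ-ring
    coefficient : ∀ r → fromℕ (pathCount (suc N) 0 r) ≡ (ℤ.+ ((suc N C r) ℕ.* (N C r))) ℚ./ suc r
    coefficient r = trans (sym ([1+r]*c/[1+r]≡c r (pathCount (suc N) 0 r)))
      (cong (λ z → ℤ.+ z ℚ./ suc r) (trans (narayana-count N r) (cong₂ ℕ._*_ (binom≡C (suc N) r) (binom≡C N r))))


0≤+ : ∀ {a b} → 0ℚ ℚ.≤ a → 0ℚ ℚ.≤ b → 0ℚ ℚ.≤ a + b
0≤+ = ℚP.+-mono-≤

0≤* : ∀ {a b} → 0ℚ ℚ.≤ a → 0ℚ ℚ.≤ b → 0ℚ ℚ.≤ a * b
0≤* {a} {b} 0≤a 0≤b = ℚP.nonNegative⁻¹ (a * b) {{ℚP.nonNeg*nonNeg⇒nonNeg a {{ℚ.nonNegative 0≤a}} b {{ℚ.nonNegative 0≤b}}}}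

0<* : ∀ {a b} → 0ℚ < a → 0ℚ < b → 0ℚ < a * b
0<* {a} {b} 0<a 0<b = ℚP.positive⁻¹ (a * b) {{ℚP.pos*pos⇒pos a {{ℚ.positive 0<a}} b {{ℚ.positive 0<b}}}}

/'≡÷ : ∀ p q (q≢0 : q ≢ 0ℚ) → p /' q ≡ (p ℚ.÷ q) {{ℚ.≢-nonZero q≢0}}
/'≡÷ p q@(ℚ.mkℚ (ℤ.+ zero) _ _) q≢0 = ⊥-elim (q≢0 (ℚP.↥p≡0⇒p≡0 q refl))
/'≡÷ p (ℚ.mkℚ (ℤ.+ suc n) _ _)   q≢0 = refl
/'≡÷ p (ℚ.mkℚ ℤ.-[1+ n ] _ _)    q≢0 = refl

module Positivity (γ : ℚ) (0<γ : 0ℚ < γ) where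
  open Transfer γ

  0≤γ : 0ℚ ℚ.≤ γ
  0≤γ = ℚP.<⇒≤ 0<γ

  pathSum-nonNeg : ∀ n h → 0ℚ ℚ.≤ pathSum n h
  pathSum-nonNeg zero    zero    = ℚP.nonNegative⁻¹ 1ℚ
  pathSum-nonNeg zero    (suc h) = ℚP.≤-refl
  pathSum-nonNeg (suc n) zero    = 0≤+ (pathSum-nonNeg n 0) (0≤* 0≤γ (pathSum-nonNeg n 1))
  pathSum-nonNeg (suc n) (suc h) = 0≤+ (0≤+ (pathSum-nonNeg n h) (0≤* (0≤+ (ℚP.nonNegative⁻¹ 1ℚ) 0≤γ) (pathSum-nonNeg n (suc h))))
                                       (0≤* 0≤γ (pathSum-nonNeg n (suc (suc h))))

  pathSum-pos : ∀ n → 0ℚ < pathSum n 0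
  pathSum-pos zero    = ℚP.positive⁻¹ 1ℚ
  pathSum-pos (suc n) = ℚP.+-mono-<-≤ (pathSum-pos n) (0≤* 0≤γ (pathSum-nonNeg n 1))

module Moments (γ : ℚ) (0<γ : 0ℚ < γ) (n : ℕ) where
  open Transfer γ
  open PathSums γ
  open Coefficients γ

  k : ℕ
  k = suc n

  Nk : ℚ
  Nk = Narayana k γ

  Σℚ-AM : ∀ (g : List Step → ℚ) → Σℚ (AM k) g ≡ Σℚ (words (double k)) (λ w → ι (altCheck 1 0 w) * g w)
  Σℚ-AM g = begin
      Σℚ (filterᵇ (altCheck 1 0) (words (2 ℕ.* k))) g
        ≡⟨ Σℚ-filterᵇ (altCheck 1 0) (words (2 ℕ.* k)) g ⟩
      Σℚ (words (2 ℕ.* k)) (λ w → if altCheck 1 0 w then g w else 0ℚ)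
        ≡⟨ Σℚ-cong (words (2 ℕ.* k)) (λ w → if-then-0≡ι* (altCheck 1 0 w) (g w)) ⟩
      Σℚ (words (2 ℕ.* k)) (λ w → ι (altCheck 1 0 w) * g w)
        ≡⟨ cong (λ m → Σℚ (words m) (λ w → ι (altCheck 1 0 w) * g w)) (sym (double≡2* k)) ⟩
      Σℚ (words (double k)) (λ w → ι (altCheck 1 0 w) * g w) ∎
    where open ≡-Reasoning

  partition≡Narayana : Σℚ (AM k) (λ p → γ ^ rises p) ≡ Nk
  partition≡Narayana = trans (Σℚ-AM (λ p → γ ^ rises p)) (trans (Σweight≡pathSum k 0) (pathSum≡Narayana n))

  ΣR ΣL : ℕ → ℚ
  ΣR i = Σℚ (AM k) (λ p → γ ^ rises p * fromℕ (R i p))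
  ΣL i = Σℚ (AM k) (λ p → γ ^ rises p * fromℕ (L i p))

  ΣR≡pathSum : ∀ i → ΣR i ≡ γ ^ suc i * pathSum k (suc (i ℕ.+ suc i))
  ΣR≡pathSum i = trans (Σℚ-AM (λ p → γ ^ rises p * fromℕ (R i p))) (ΣweightR≡pathSum i n)

  ΣL≡pathSum : ∀ i → ΣL i ≡ γ ^ i * pathSum k (suc (i ℕ.+ i))
  ΣL≡pathSum i = trans (Σℚ-AM (λ p → γ ^ rises p * fromℕ (L i p))) (ΣweightL≡pathSum i n)

  0<Nk : 0ℚ < Nk
  0<Nk = subst (0ℚ <_) (pathSum≡Narayana n) (Positivity.pathSum-pos γ 0<γ k)

  Nk≢0 : Nk ≢ 0ℚ
  Nk≢0 Nk≡0 = ℚP.<⇒≢ 0<Nk (sym Nk≡0)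

  Nk²≢0 : Nk * Nk ≢ 0ℚ
  Nk²≢0 Nk²≡0 = ℚP.<⇒≢ (0<* 0<Nk 0<Nk) (sym Nk²≡0)

  instance
    Nk-nonZero : ℚ.NonZero Nk
    Nk-nonZero = ℚ.≢-nonZero Nk≢0
    Nk²-nonZero : ℚ.NonZero (Nk * Nk)
    Nk²-nonZero = ℚ.≢-nonZero Nk²≢0

  1/Nk² : ℚ
  1/Nk² = ℚ.1/ (Nk * Nk)

  1/Nk*1/Nk : ℚ.1/ Nk * ℚ.1/ Nk ≡ 1/Nk²
  1/Nk*1/Nk = begin
      z * z                          ≡⟨ sym (ℚP.*-identityʳ (z * z)) ⟩
      z * z * 1ℚ                     ≡⟨ cong (z * z *_) (sym (ℚP.*-inverseʳ (Nk * Nk))) ⟩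
      z * z * ((Nk * Nk) * 1/Nk²)    ≡⟨ regroup z Nk 1/Nk² ⟩
      ((Nk * z) * (Nk * z)) * 1/Nk²  ≡⟨ cong₂ (λ a b → (a * b) * 1/Nk²) (ℚP.*-inverseʳ Nk) (ℚP.*-inverseʳ Nk) ⟩
      (1ℚ * 1ℚ) * 1/Nk²              ≡⟨ ℚP.*-identityˡ 1/Nk² ⟩
      1/Nk²                          ∎
    where
    open ≡-Reasoning
    z = ℚ.1/ Nk
    regroup : ∀ z n w → z * z * ((n * n) * w) ≡ ((n * z) * (n * z)) * w
    regroup = ℚ-solve ℚ-ring

  normSq-E : ∀ (X : ℕ → List Step → ℕ) →
             normSq k (λ i → E k γ (λ p → fromℕ (X i p)))
               ≡ Σ< k (λ i → Σℚ (AM k) (λ p → γ ^ rises p * fromℕ (X i p)) * Σℚ (AM k) (λ p → γ ^ rises p * fromℕ (X i p))) * 1/Nk²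
  normSq-E X = begin
      Σ< k (λ i → E k γ (Xℚ i) * E k γ (Xℚ i))
        ≡⟨ Σ<-cong k (λ i → cong (λ e → e * e) (E≡ i)) ⟩
      Σ< k (λ i → (S i * ℚ.1/ Nk) * (S i * ℚ.1/ Nk))
        ≡⟨ Σ<-cong k (λ i → trans (interchange (S i) (ℚ.1/ Nk)) (cong (S i * S i *_) 1/Nk*1/Nk)) ⟩
      Σ< k (λ i → S i * S i * 1/Nk²)
        ≡⟨ Σℚ-*ʳ (upTo k) 1/Nk² (λ i → S i * S i) ⟩
      Σ< k (λ i → S i * S i) * 1/Nk² ∎
    where
    open ≡-Reasoning
    Xℚ : ℕ → List Step → ℚ
    Xℚ i p = fromℕ (X i p)
    S : ℕ → ℚ
    S i = Σℚ (AM k) (λ p → γ ^ rises p * Xℚ i p)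
    E≡ : ∀ i → E k γ (Xℚ i) ≡ S i * ℚ.1/ Nk
    E≡ i = trans (cong (S i /'_) partition≡Narayana) (/'≡÷ (S i) Nk Nk≢0)
    interchange : ∀ s z → (s * z) * (s * z) ≡ s * s * (z * z)
    interchange = ℚ-solve ℚ-ring

  double-sum : ℚ
  double-sum = Σℚ (AM k) (λ p₁ → Σℚ (AM k) (λ p₂ →
                 γ ^ (rises p₁ ℕ.+ rises p₂)
                 * (Σ< k (λ i → fromℕ (R i p₁ ℕ.* R i p₂)) + γ * Σ< k (λ i → fromℕ (L i p₁ ℕ.* L i p₂)))))

  double-sum≡ : double-sum ≡ Σ< k (λ i → ΣR i * ΣR i) + γ * Σ< k (λ i → ΣL i * ΣL i)
  double-sum≡ = begin
      double-sum
        ≡⟨ Σℚ-cong (AM k) (λ p₁ → Σℚ-cong (AM k) (λ p₂ → separate p₁ p₂)) ⟩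
      Σℚ (AM k) (λ p₁ → Σℚ (AM k) (λ p₂ → Σ< k (λ i → U R i p₁ * U R i p₂) + γ * Σ< k (λ i → U L i p₁ * U L i p₂)))
        ≡⟨ Σℚ-cong (AM k) (λ p₁ → Σℚ-linear (AM k) (λ p₂ → Σ< k (λ i → U R i p₁ * U R i p₂))
                                                   (λ p₂ → Σ< k (λ i → U L i p₁ * U L i p₂))) ⟩
      Σℚ (AM k) (λ p₁ → Σℚ (AM k) (λ p₂ → Σ< k (λ i → U R i p₁ * U R i p₂))
                       + γ * Σℚ (AM k) (λ p₂ → Σ< k (λ i → U L i p₁ * U L i p₂)))
        ≡⟨ Σℚ-linear (AM k) (λ p₁ → Σℚ (AM k) (λ p₂ → Σ< k (λ i → U R i p₁ * U R i p₂)))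
                            (λ p₁ → Σℚ (AM k) (λ p₂ → Σ< k (λ i → U L i p₁ * U L i p₂))) ⟩
      Σℚ (AM k) (λ p₁ → Σℚ (AM k) (λ p₂ → Σ< k (λ i → U R i p₁ * U R i p₂)))
        + γ * Σℚ (AM k) (λ p₁ → Σℚ (AM k) (λ p₂ → Σ< k (λ i → U L i p₁ * U L i p₂)))
        ≡⟨ cong₂ (λ a b → a + γ * b) (Σℚ-Σℚ-Σ<-square (AM k) k (U R)) (Σℚ-Σℚ-Σ<-square (AM k) k (U L)) ⟩
      Σ< k (λ i → ΣR i * ΣR i) + γ * Σ< k (λ i → ΣL i * ΣL i) ∎
    where
    open ≡-Reasoning
    U : (ℕ → List Step → ℕ) → ℕ → List Step → ℚ
    U X i p = γ ^ rises p * fromℕ (X i p)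
    Σℚ-linear : ∀ (xs : List (List Step)) (f g : List Step → ℚ) →
                Σℚ xs (λ x → f x + γ * g x) ≡ Σℚ xs f + γ * Σℚ xs g
    Σℚ-linear xs f g = trans (Σℚ-+ xs f (λ x → γ * g x)) (cong (Σℚ xs f +_) (Σℚ-*ˡ xs γ g))
    factor : ∀ (X : ℕ → List Step → ℕ) p₁ p₂ →
             γ ^ rises p₁ * γ ^ rises p₂ * Σ< k (λ i → fromℕ (X i p₁ ℕ.* X i p₂)) ≡ Σ< k (λ i → U X i p₁ * U X i p₂)
    factor X p₁ p₂ = trans (sym (Σℚ-*ˡ (upTo k) (γ ^ rises p₁ * γ ^ rises p₂) (λ i → fromℕ (X i p₁ ℕ.* X i p₂))))
      (Σ<-cong k (λ i → trans (cong (γ ^ rises p₁ * γ ^ rises p₂ *_) (fromℕ-* (X i p₁) (X i p₂)))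
                               (interchange (γ ^ rises p₁) (γ ^ rises p₂) (fromℕ (X i p₁)) (fromℕ (X i p₂)))))
      where
      interchange : ∀ a b x y → a * b * (x * y) ≡ (a * x) * (b * y)
      interchange = ℚ-solve ℚ-ring
    separate : ∀ p₁ p₂ →
      γ ^ (rises p₁ ℕ.+ rises p₂) * (Σ< k (λ i → fromℕ (R i p₁ ℕ.* R i p₂)) + γ * Σ< k (λ i → fromℕ (L i p₁ ℕ.* L i p₂)))
      ≡ Σ< k (λ i → U R i p₁ * U R i p₂) + γ * Σ< k (λ i → U L i p₁ * U L i p₂)
    separate p₁ p₂ = begin
        γ ^ (rises p₁ ℕ.+ rises p₂) * (SR + γ * SL)
          ≡⟨ cong (_* (SR + γ * SL)) (^-+ γ (rises p₁) (rises p₂)) ⟩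
        γ ^ rises p₁ * γ ^ rises p₂ * (SR + γ * SL)
          ≡⟨ distribute (γ ^ rises p₁ * γ ^ rises p₂) γ SR SL ⟩
        γ ^ rises p₁ * γ ^ rises p₂ * SR + γ * (γ ^ rises p₁ * γ ^ rises p₂ * SL)
          ≡⟨ cong₂ (λ a b → a + γ * b) (factor R p₁ p₂) (factor L p₁ p₂) ⟩
        Σ< k (λ i → U R i p₁ * U R i p₂) + γ * Σ< k (λ i → U L i p₁ * U L i p₂) ∎
      where
      SR = Σ< k (λ i → fromℕ (R i p₁ ℕ.* R i p₂))
      SL = Σ< k (λ i → fromℕ (L i p₁ ℕ.* L i p₂))
      distribute : ∀ c g a b → c * (a + g * b) ≡ c * a + g * (c * b)
      distribute = ℚ-solve ℚ-ring

  Nk²+ΣR²+γΣL²≡N2k : Nk * Nk + (Σ< k (λ i → ΣR i * ΣR i) + γ * Σ< k (λ i → ΣL i * ΣL i)) ≡ Narayana (2 ℕ.* k) γ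
  Nk²+ΣR²+γΣL²≡N2k = begin
      Nk * Nk + (Σ< k (λ i → ΣR i * ΣR i) + γ * Σ< k (λ i → ΣL i * ΣL i))
        ≡⟨ cong₂ _+_ (sym F0≡) (trans (ℚP.+-comm (Σ< k (λ i → ΣR i * ΣR i)) (γ * Σ< k (λ i → ΣL i * ΣL i))) (sym odd+even)) ⟩
      F 0 + Σ< k (λ i → F (suc (i ℕ.+ i)) + F (suc (i ℕ.+ suc i)))
        ≡⟨ sym (Σ<-parity k F) ⟩
      Σ< (suc (k ℕ.+ k)) F
        ≡⟨ Σγ^h*pathSum²≡pathSum k ⟩
      pathSum (k ℕ.+ k) 0
        ≡⟨ pathSum≡Narayana (n ℕ.+ k) ⟩
      Narayana (k ℕ.+ k) γ
        ≡⟨ cong (λ m → Narayana m γ) (sym (2*k≡k+k k)) ⟩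
      Narayana (2 ℕ.* k) γ ∎
    where
    open ≡-Reasoning
    F : ℕ → ℚ
    F h = γ ^ h * (pathSum k h * pathSum k h)
    2*k≡k+k : ∀ k → 2 ℕ.* k ≡ k ℕ.+ k
    2*k≡k+k = ℕ-Solver.solve-∀
    F0≡ : F 0 ≡ Nk * Nk
    F0≡ = trans (ℚP.*-identityˡ _) (cong₂ _*_ (pathSum≡Narayana n) (pathSum≡Narayana n))
    odd : ∀ i → F (suc (i ℕ.+ i)) ≡ γ * (ΣL i * ΣL i)
    odd i = begin
        (γ * γ ^ (i ℕ.+ i)) * (x * x)        ≡⟨ cong (λ z → (γ * z) * (x * x)) (^-+ γ i i) ⟩
        (γ * (γ ^ i * γ ^ i)) * (x * x)      ≡⟨ regroup γ (γ ^ i) x ⟩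
        γ * ((γ ^ i * x) * (γ ^ i * x))      ≡⟨ cong (λ z → γ * (z * z)) (sym (ΣL≡pathSum i)) ⟩
        γ * (ΣL i * ΣL i)                    ∎
      where
      x = pathSum k (suc (i ℕ.+ i))
      regroup : ∀ g p x → (g * (p * p)) * (x * x) ≡ g * ((p * x) * (p * x))
      regroup = ℚ-solve ℚ-ring
    even : ∀ i → F (suc (i ℕ.+ suc i)) ≡ ΣR i * ΣR i
    even i = begin
        (γ * γ ^ (i ℕ.+ suc i)) * (x * x)    ≡⟨ cong (λ z → (γ * z) * (x * x)) (^-+ γ i (suc i)) ⟩
        (γ * (γ ^ i * γ ^ suc i)) * (x * x)  ≡⟨ regroup γ (γ ^ i) x ⟩
        (γ ^ suc i * x) * (γ ^ suc i * x)    ≡⟨ cong (λ z → z * z) (sym (ΣR≡pathSum i)) ⟩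
        ΣR i * ΣR i                          ∎
      where
      x = pathSum k (suc (i ℕ.+ suc i))
      regroup : ∀ g p x → (g * (p * (g * p))) * (x * x) ≡ ((g * p) * x) * ((g * p) * x)
      regroup = ℚ-solve ℚ-ring
    odd+even : Σ< k (λ i → F (suc (i ℕ.+ i)) + F (suc (i ℕ.+ suc i)))
               ≡ γ * Σ< k (λ i → ΣL i * ΣL i) + Σ< k (λ i → ΣR i * ΣR i)
    odd+even = trans (Σ<-cong k (λ i → cong₂ _+_ (odd i) (even i)))
      (trans (Σℚ-+ (upTo k) (λ i → γ * (ΣL i * ΣL i)) (λ i → ΣR i * ΣR i))
             (cong (_+ Σ< k (λ i → ΣR i * ΣR i)) (Σℚ-*ˡ (upTo k) γ (λ i → ΣL i * ΣL i))))

  normSq-E≡double-sum/Nk² :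
    normSq k (λ i → E k γ (λ p → fromℕ (R i p))) + γ * normSq k (λ i → E k γ (λ p → fromℕ (L i p)))
      ≡ double-sum /' (Nk * Nk)
  normSq-E≡double-sum/Nk² = begin
      normSq k (λ i → E k γ (λ p → fromℕ (R i p))) + γ * normSq k (λ i → E k γ (λ p → fromℕ (L i p)))
        ≡⟨ cong₂ (λ a b → a + γ * b) (normSq-E R) (normSq-E L) ⟩
      Σ< k (λ i → ΣR i * ΣR i) * 1/Nk² + γ * (Σ< k (λ i → ΣL i * ΣL i) * 1/Nk²)
        ≡⟨ factor (Σ< k (λ i → ΣR i * ΣR i)) (Σ< k (λ i → ΣL i * ΣL i)) γ 1/Nk² ⟩
      (Σ< k (λ i → ΣR i * ΣR i) + γ * Σ< k (λ i → ΣL i * ΣL i)) * 1/Nk²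
        ≡⟨ cong (_* 1/Nk²) (sym double-sum≡) ⟩
      double-sum * 1/Nk²
        ≡⟨ sym (/'≡÷ double-sum (Nk * Nk) Nk²≢0) ⟩
      double-sum /' (Nk * Nk) ∎
    where
    open ≡-Reasoning
    factor : ∀ a b g z → a * z + g * (b * z) ≡ (a + g * b) * z
    factor = ℚ-solve ℚ-ring

  double-sum/Nk²≡N2k/Nk²-1 : double-sum /' (Nk * Nk) ≡ Narayana (2 ℕ.* k) γ /' (Nk * Nk) - 1ℚ
  double-sum/Nk²≡N2k/Nk²-1 = begin
      double-sum /' (Nk * Nk)
        ≡⟨ /'≡÷ double-sum (Nk * Nk) Nk²≢0 ⟩
      double-sum * 1/Nk²
        ≡⟨ cong (_* 1/Nk²) (trans double-sum≡ (cancel (Nk * Nk) _ _ Nk²+ΣR²+γΣL²≡N2k)) ⟩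
      (N2k - Nk * Nk) * 1/Nk²
        ≡⟨ distribute N2k (Nk * Nk) 1/Nk² ⟩
      N2k * 1/Nk² - (Nk * Nk) * 1/Nk²
        ≡⟨ cong (N2k * 1/Nk² -_) (ℚP.*-inverseʳ (Nk * Nk)) ⟩
      N2k * 1/Nk² - 1ℚ
        ≡⟨ cong (_- 1ℚ) (sym (/'≡÷ N2k (Nk * Nk) Nk²≢0)) ⟩
      N2k /' (Nk * Nk) - 1ℚ ∎
    where
    open ≡-Reasoning
    N2k = Narayana (2 ℕ.* k) γ
    cancel : ∀ a x b → a + x ≡ b → x ≡ b - a
    cancel a x b refl = move a x
      where
      move : ∀ a x → x ≡ (a + x) - a
      move = ℚ-solve ℚ-ring
    distribute : ∀ a b w → (a - b) * w ≡ a * w - b * w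
    distribute = ℚ-solve ℚ-ring

theorem3 : (k : ℕ) → 1 ≤ k → (γ : ℚ) → 0ℚ < γ →
    (normSq k (λ i → E k γ (λ p → fromℕ (R i p)))
       + γ * normSq k (λ i → E k γ (λ p → fromℕ (L i p)))
     ≡ Σℚ (AM k) (λ p₁ → Σℚ (AM k) (λ p₂ →
          γ ^ (rises p₁ ℕ.+ rises p₂)
          * (Σ< k (λ i → fromℕ (R i p₁ ℕ.* R i p₂))
             + γ * Σ< k (λ i → fromℕ (L i p₁ ℕ.* L i p₂)))))
       /' (Narayana k γ * Narayana k γ))
    × (Σℚ (AM k) (λ p₁ → Σℚ (AM k) (λ p₂ →
          γ ^ (rises p₁ ℕ.+ rises p₂)
          * (Σ< k (λ i → fromℕ (R i p₁ ℕ.* R i p₂))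
             + γ * Σ< k (λ i → fromℕ (L i p₁ ℕ.* L i p₂)))))
       /' (Narayana k γ * Narayana k γ)
     ≡ Narayana (2 ℕ.* k) γ /' (Narayana k γ * Narayana k γ) - 1ℚ)
theorem3 (suc n) _ γ 0<γ = normSq-E≡double-sum/Nk² , double-sum/Nk²≡N2k/Nk²-1
  where open Moments γ 0<γ n
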